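{- For every integer $n\ge2$, the Catalan polynomial $Y=C^{\star}_n(X)$ satisfies $$(3(n+1)X^2+8(2n-1)^2X)Y''+(3(n+1)X^2+8(2n-1)^2X+8(2n-1)^2)Y'+(6(n+1)(1-n)X-4(2n-1)(8n^2-13n+3))Y=0.$$
   Context: For an integer $n\ge 1$, $\mathfrak G_{n,n}$ is the digraph with vertices $v_1,\dots,v_n,u_1,\dots,u_n$ and arcs $(v_j,v_{j+1})$ and $(u_j,u_{j+1})$ for $1\le j<n$, and $(v_j,u_j)$ for $1\le j\le n$. For a finite simple digraph $\mathfrak G=(V,A)$ with $|V|=N$, a disposition is a bijection $f:V\to\{1,\dots,N\}$ with $f(w_1)>f(w_2)$ whenever $(w_1,w_2)\in A$, and $\sigma(\mathfrak G)$ is the number of dispositions. For $v\in V$ and $i\ge0$, $\mathfrak G_i$ is obtained from $\mathfrak G$ by adding new vertices $z_1,\dots,z_i$ and arcs $(z_0,z_1),\dots,(z_{i-1},z_i)$ with $z_0=v$. The companion polynomial $T_{\mathfrak G,v}(X)$ is the (polynomial) power series satisfying $\sum_{i\ge0}\sigma(\mathfrak G_i)X^i/i!=T_{\mathfrak G,v}(X)\exp(X)$. For $n\ge2$, the Catalan polynomial is $C^{\star}_n(X)=T_{\mathfrak G_{n,n},v_2}(X)$. -}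

module Defs where

open import Data.Nat as ℕ using (ℕ; zero; suc; _∸_; _<_)
open import Data.Nat.Properties using (_!≢0)
open import Data.Nat.Combinatorics using ()
open import Data.Nat.Base using (_!)
open import Data.Fin as Fin using (Fin; toℕ)
open import Data.Fin.Properties using (all?; any?) renaming (_≟_ to _≟ᶠ_)
open import Data.Integer as ℤ using (ℤ; +_)
open import Data.Rational as ℚ using (ℚ; _/_; 0ℚ)
open import Data.List as List using (List; []; _∷_; map; upTo; concatMap; filter; length; _++_; allFin)
open import Data.List.Membership.Propositional using (_∈_)
import Data.List.Membership.DecPropositional as DecMem
open import Data.Product using (_×_; _,_; ∃)
open import Data.Product.Properties using (≡-dec)
import Data.Nat.Properties as ℕP
open import Data.Vec.Functional using (Vector) renaming (_∷_ to _∷ᵥ_)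
open import Relation.Binary.PropositionalEquality using (_≡_)
open import Relation.Nullary using (Dec; _×-dec_; _→-dec_)

-- Finite simple digraphs: vertices are 0 , … , N-1 (i.e. Fin N);
-- arcs are given as a list of pairs of vertex indices (w₁ , w₂),
-- meaning the arc (w₁ , w₂).

record Digraph : Set where
  constructor digraph
  field
    N    : ℕ
    arcs : List (ℕ × ℕ)
open Digraph public

_≟ℕ²_ : (p q : ℕ × ℕ) → Dec (p ≡ q)
_≟ℕ²_ = ≡-dec ℕP._≟_ ℕP._≟_

open DecMem _≟ℕ²_ using (_∈?_)

Bijective : {N : ℕ} → (Fin N → Fin N) → Set
Bijective {N} f = (∀ x y → f x ≡ f y → x ≡ y) × (∀ y → ∃ λ x → f x ≡ y)

-- A disposition of G: a bijection f : V → {1,…,N} (here Fin N, i.e. shifted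
-- by one, which does not affect the order condition) with
-- f(w₁) > f(w₂) whenever (w₁ , w₂) is an arc.
IsDisposition : (G : Digraph) → (Fin (N G) → Fin (N G)) → Set
IsDisposition G f =
  Bijective f ×
  (∀ (a b : Fin (N G)) → (toℕ a , toℕ b) ∈ arcs G → f b Fin.< f a)

bijective? : {N : ℕ} (f : Fin N → Fin N) → Dec (Bijective f)
bijective? f =
  all? (λ x → all? (λ y → (f x ≟ᶠ f y) →-dec (x ≟ᶠ y)))
  ×-dec all? (λ y → any? (λ x → f x ≟ᶠ y))

isDisposition? : (G : Digraph) (f : Fin (N G) → Fin (N G)) → Dec (IsDisposition G f)
isDisposition? G f =
  bijective? f ×-dec
  all? (λ a → all? (λ b → ((toℕ a , toℕ b) ∈? arcs G) →-dec (f b Fin.<? f a)))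

allFuns : (m k : ℕ) → List (Fin m → Fin k)
allFuns zero    k = (λ ()) ∷ []
allFuns (suc m) k = concatMap (λ y → map (λ g → y ∷ᵥ g) (allFuns m k)) (allFin k)

σ : Digraph → ℕ
σ G = length (filter (isDisposition? G) (allFuns (N G) (N G)))

-- The digraph 𝔊_{n,n} with a tail of length i attached at v₂.
-- Vertex indices: v_j ↦ j-1 (1 ≤ j ≤ n), u_j ↦ n+j-1 (1 ≤ j ≤ n),
-- z_k ↦ 2n+k-1 (1 ≤ k ≤ i).  So v₂ ↦ 1.

arcsGnn : ℕ → List (ℕ × ℕ)
arcsGnn n =
  map (λ k → (k , suc k)) (upTo (n ∸ 1))
  ++ map (λ k → (n ℕ.+ k , n ℕ.+ suc k)) (upTo (n ∸ 1))
  ++ map (λ k → (k , n ℕ.+ k)) (upTo n)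

Gnn : ℕ → Digraph
Gnn n = digraph (n ℕ.+ n) (arcsGnn n)

-- arcs (z₀,z₁),…,(z_{i-1},z_i) with z₀ = vertex index v, z_k ↦ base+k-1
tailArcs : (v base i : ℕ) → List (ℕ × ℕ)
tailArcs v base zero    = []
tailArcs v base (suc i) = (v , base) ∷ tailArcs base (suc base) i

attachTail : Digraph → (v : ℕ) → (i : ℕ) → Digraph
attachTail G v i = digraph (N G ℕ.+ i) (arcs G ++ tailArcs v (N G) i)

PS : Set
PS = ℕ → ℚ

ℕ→ℚ : ℕ → ℚ
ℕ→ℚ n = (+ n) / 1

ℤ→ℚ : ℤ → ℚ
ℤ→ℚ z = z / 1

sumTo : ℕ → (ℕ → ℚ) → ℚ
sumTo zero    f = f 0
sumTo (suc k) f = sumTo k f ℚ.+ f (suc k)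

expNeg : PS
expNeg j = ((ℤ.- (+ 1)) ℤ.^ j) / (j !) where instance _ = j !≢0

_⊛_ : PS → PS → PS
(a ⊛ b) k = sumTo k (λ i → a i ℚ.* b (k ∸ i))

infixl 6 _⊕_
infixr 7 _·_
_⊕_ : PS → PS → PS
(a ⊕ b) k = a k ℚ.+ b k

_·_ : ℚ → PS → PS
(c · a) k = c ℚ.* a k

D : PS → PS
D a k = ℕ→ℚ (suc k) ℚ.* a (suc k)

mulX : PS → PS
mulX a zero    = 0ℚ
mulX a (suc k) = a k

-- Companion series T_{G,v}: the unique series with
-- Σ σ(G_i) X^i / i! = T_{G,v}(X) · exp(X), i.e. T = (Σ σ(G_i) X^i/i!) · exp(-X).
egf : (ℕ → ℕ) → PS
egf s i = (+ s i) / (i !) where instance _ = i !≢0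

companion : Digraph → ℕ → PS
companion G v = egf (λ i → σ (attachTail G v i)) ⊛ expNeg

-- Catalan polynomial C*_n = T_{𝔊_{n,n}, v₂}  (v₂ has index 1)
Cstar : ℕ → PS
Cstar n = companion (Gnn n) 1

{-# OPTIONS --safe #-}
-- Listing the vertices by decreasing label identifies dispositions with topological
-- sorts, which are counted by repeatedly removing a source.  Once v₂ has been removed
-- the tail is independent of the ladder, so the count of what remains is a binomial
-- coefficient times a ballot number; this gives
--   σ(𝔊ᵢ) = A·C(N+i, i) + B·C(N-1+i, i),  N = 2n-2,  A, B ballot numbers with (n+1)A = 3(n-1)B.
-- Binomial inversion then yields 2(n-1)(n+1)·C⋆ₙ(X) = B·Σᵣ q(r) C(N,r) Xʳ/r! with
-- q(r) = 4(n-1)(2n-1) - (n+1)r.  As sᵣ = C(N,r)/r! satisfies (r+1)² sᵣ₊₁ = (N-r) sᵣ,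
-- the equation becomes, coefficientwise, a polynomial identity in n and r.
module Submission where

module RationalRing where

  open import Relation.Nullary.Decidable.Core using (dec⇒maybe)
  open import Data.Rational using (0ℚ)
  open import Data.Rational.Properties using (_≟_; +-*-commutativeRing)
  open import Level using (0ℓ)
  open import Tactic.RingSolver.Core.AlmostCommutativeRing using (AlmostCommutativeRing; fromCommutativeRing)

  ℚ-ring : AlmostCommutativeRing 0ℓ 0ℓ
  ℚ-ring = fromCommutativeRing +-*-commutativeRing (λ x → dec⇒maybe (0ℚ ≟ x))

module Binomial where

  open import Data.Nat
  open import Data.Nat.Properties
  open import Data.Nat.Combinatorics using (_C_; nCk+nC[k+1]≡[n+1]C[k+1]; nC1≡n; nCk≡n!/k![n-k]!; k![n∸k]!∣n!)
  open import Data.Nat.DivMod using (m*[n/m]≡n)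
  open import Data.Nat.Tactic.RingSolver using (solve-∀)
  open import Relation.Binary.PropositionalEquality

  [n+1]C[k+1]≡nCk+nC[k+1] : ∀ n k → suc n C suc k ≡ n C k + n C suc k
  [n+1]C[k+1]≡nCk+nC[k+1] n k = sym (nCk+nC[k+1]≡[n+1]C[k+1] n k)

  [k+1]*[n+1]C[k+1]≡[n+1]*nCk : ∀ n k → suc k * (suc n C suc k) ≡ suc n * (n C k)
  [k+1]*[n+1]C[k+1]≡[n+1]*nCk zero    zero    = refl
  [k+1]*[n+1]C[k+1]≡[n+1]*nCk zero    (suc k) = *-zeroʳ (2 + k)
  [k+1]*[n+1]C[k+1]≡[n+1]*nCk (suc n) zero    =
    trans (*-identityˡ _) (trans (nC1≡n (2 + n)) (sym (*-identityʳ (2 + n))))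
  [k+1]*[n+1]C[k+1]≡[n+1]*nCk (suc n) (suc k) = begin
    suc (suc k) * (suc (suc n) C suc (suc k))
      ≡⟨ cong (suc (suc k) *_) ([n+1]C[k+1]≡nCk+nC[k+1] (suc n) (suc k)) ⟩
    suc (suc k) * (suc n C suc k + suc n C suc (suc k))
      ≡⟨ split (suc k) (suc n C suc k) (suc n C suc (suc k)) ⟩
    suc k * (suc n C suc k) + suc n C suc k + suc (suc k) * (suc n C suc (suc k))
      ≡⟨ cong₂ (λ x y → x + suc n C suc k + y)
               ([k+1]*[n+1]C[k+1]≡[n+1]*nCk n k) ([k+1]*[n+1]C[k+1]≡[n+1]*nCk n (suc k)) ⟩
    suc n * (n C k) + suc n C suc k + suc n * (n C suc k)
      ≡⟨ collect (suc n) (n C k) (n C suc k) (suc n C suc k) ⟩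
    suc n * (n C k + n C suc k) + suc n C suc k
      ≡⟨ cong (λ x → suc n * x + suc n C suc k) (sym ([n+1]C[k+1]≡nCk+nC[k+1] n k)) ⟩
    suc n * (suc n C suc k) + suc n C suc k
      ≡⟨ +-comm (suc n * (suc n C suc k)) _ ⟩
    suc (suc n) * (suc n C suc k) ∎
    where
    open ≡-Reasoning
    split : ∀ k x y → suc k * (x + y) ≡ k * x + x + suc k * y
    split = solve-∀
    collect : ∀ m a b c → m * a + c + m * b ≡ m * (a + b) + c
    collect = solve-∀

  [k+1]*nC[k+1]+k*nCk≡n*nCk : ∀ n k → suc k * (n C suc k) + k * (n C k) ≡ n * (n C k)
  [k+1]*nC[k+1]+k*nCk≡n*nCk n k = +-cancelʳ-≡ (n C k) _ _ (begin
    suc k * (n C suc k) + k * (n C k) + n C k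
      ≡⟨ collect (n C suc k) (n C k) k ⟩
    suc k * (n C k + n C suc k)
      ≡⟨ cong (suc k *_) (sym ([n+1]C[k+1]≡nCk+nC[k+1] n k)) ⟩
    suc k * (suc n C suc k)
      ≡⟨ [k+1]*[n+1]C[k+1]≡[n+1]*nCk n k ⟩
    suc n * (n C k)
      ≡⟨ +-comm (n C k) (n * (n C k)) ⟩
    n * (n C k) + n C k ∎)
    where
    open ≡-Reasoning
    collect : ∀ c′ c k → suc k * c′ + k * c + c ≡ suc k * (c + c′)
    collect = solve-∀

  [n+1]*nCk+k*[n+1]Ck≡[n+1]*[n+1]Ck : ∀ n k → suc n * (n C k) + k * (suc n C k) ≡ suc n * (suc n C k)
  [n+1]*nCk+k*[n+1]Ck≡[n+1]*[n+1]Ck n k =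
    trans (cong (_+ k * (suc n C k)) (sym ([k+1]*[n+1]C[k+1]≡[n+1]*nCk n k)))
          ([k+1]*nC[k+1]+k*nCk≡n*nCk (suc n) k)

  k!*[n∸k]!*nCk≡n! : ∀ {n k} → k ≤ n → k ! * (n ∸ k) ! * (n C k) ≡ n !
  k!*[n∸k]!*nCk≡n! {n} {k} k≤n =
    trans (cong (k ! * (n ∸ k) ! *_) (nCk≡n!/k![n-k]! k≤n)) (m*[n/m]≡n (k![n∸k]!∣n! k≤n))
    where instance _ = m*n≢0 (k !) ((n ∸ k) !) {{k !≢0}} {{(n ∸ k) !≢0}}

module BallotNumbers where

  open import Data.Nat
  open import Data.Nat.Properties
  open import Data.Nat.Combinatorics using (_C_; nCk≡nC[n∸k])
  open import Data.Nat.Tactic.RingSolver using (solve-∀)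
  open import Relation.Binary.PropositionalEquality
  open Binomial using ([n+1]C[k+1]≡nCk+nC[k+1]; [k+1]*nC[k+1]+k*nCk≡n*nCk; [n+1]*nCk+k*[n+1]Ck≡[n+1]*[n+1]Ck)

  ballot : ℕ → ℕ → ℕ
  ballot zero    d       = 1
  ballot (suc r) zero    = ballot r 1
  ballot (suc r) (suc d) = ballot r (2 + d) + ballot (suc r) d

  middle-symmetry : ∀ r → (r + suc r) C suc r ≡ (r + suc r) C r
  middle-symmetry r = trans (nCk≡nC[n∸k] (m≤n+m (suc r) r)) (cong ((r + suc r) C_) (m+n∸n≡m r (suc r)))

  ballot-closed : ∀ p d → suc (p + d) * ballot p d ≡ suc d * ((p + (p + d)) C p)
  ballot-closed zero    d       = refl
  ballot-closed (suc r) zero    = begin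
    suc (suc r + 0) * ballot r 1              ≡⟨ shift r (ballot r 1) ⟩
    suc (r + 1) * ballot r 1                  ≡⟨ ballot-closed r 1 ⟩
    2 * ((r + (r + 1)) C r)                   ≡⟨ cong (λ z → 2 * (z C r)) (cong (r +_) (+-comm r 1)) ⟩
    2 * c                                     ≡⟨ twice c ⟩
    c + c                                     ≡⟨ cong (c +_) (sym (middle-symmetry r)) ⟩
    c + (r + suc r) C suc r                   ≡⟨ sym ([n+1]C[k+1]≡nCk+nC[k+1] (r + suc r) r) ⟩
    suc (r + suc r) C suc r                   ≡⟨ cong (_C suc r) (cong (λ z → suc (r + z)) (sym (+-identityʳ (suc r)))) ⟩
    (suc r + (suc r + 0)) C suc r             ≡⟨ sym (*-identityˡ _) ⟩
    1 * ((suc r + (suc r + 0)) C suc r)       ∎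
    where
    open ≡-Reasoning
    c = (r + suc r) C r
    shift : ∀ r b → suc (suc r + 0) * b ≡ suc (r + 1) * b
    shift = solve-∀
    twice : ∀ c → 2 * c ≡ c + c
    twice = solve-∀
  ballot-closed (suc r) (suc e) = closed-step r e (ballot-closed r (2 + e)) (ballot-closed (suc r) e)
    where
    closed-step : ∀ r e →
      suc (r + suc (suc e)) * ballot r (2 + e) ≡ suc (suc (suc e)) * ((r + (r + suc (suc e))) C r) →
      suc (suc r + e) * ballot (suc r) e ≡ suc e * ((suc r + (suc r + e)) C suc r) →
      suc (suc r + suc e) * ballot (suc r) (suc e) ≡ suc (suc e) * ((suc r + (suc r + suc e)) C suc r)
    closed-step r e ih₁ ih₂ = *-cancelˡ-≡ _ _ K (begin
      K * (suc (suc r + suc e) * (B₁ + B₂))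
        ≡⟨ split r e B₁ B₂ ⟩
      suc r * suc (r + suc e) * (suc (r + suc (suc e)) * B₁) + suc r * suc (suc r + suc e) * (suc (suc r + e) * B₂)
        ≡⟨ cong₂ (λ x y → suc r * suc (r + suc e) * x + suc r * suc (suc r + suc e) * y) IH₁ IH₂ ⟩
      suc r * suc (r + suc e) * (suc (suc (suc e)) * c) + suc r * suc (suc r + suc e) * (suc e * c′)
        ≡⟨ regroup r e c c′ ⟩
      suc r * suc (r + suc e) * (suc (suc (suc e)) * c) + suc (suc r + suc e) * suc e * (suc r * c′)
        ≡⟨ cong (λ z → suc r * suc (r + suc e) * (suc (suc (suc e)) * c) + suc (suc r + suc e) * suc e * z) c′≈c ⟩
      suc r * suc (r + suc e) * (suc (suc (suc e)) * c) + suc (suc r + suc e) * suc e * (suc (r + suc e) * c)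
        ≡⟨ balance r e c ⟩
      suc r * suc (r + suc e) * (suc (suc e) * c) + suc (r + suc e) * suc (suc e) * (suc (r + suc e) * c)
        ≡⟨ cong (λ z → suc r * suc (r + suc e) * (suc (suc e) * c) + suc (r + suc e) * suc (suc e) * z) (sym c′≈c) ⟩
      suc r * suc (r + suc e) * (suc (suc e) * c) + suc (r + suc e) * suc (suc e) * (suc r * c′)
        ≡⟨ factor r e c c′ ⟩
      K * (suc (suc e) * (c + c′))
        ≡⟨ cong (λ z → K * (suc (suc e) * z)) (sym (trans (cong (_C suc r) (size r e)) ([n+1]C[k+1]≡nCk+nC[k+1] N r))) ⟩
      K * (suc (suc e) * ((suc r + (suc r + suc e)) C suc r)) ∎)
      where
      open ≡-Reasoning
      K = suc r * suc (r + suc e)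
      instance _ = m*n≢0 (suc r) (suc (r + suc e))
      B₁ = ballot r (2 + e)
      B₂ = ballot (suc r) e
      N = r + suc (r + suc e)
      c = N C r
      c′ = N C suc r
      size : ∀ r e → suc r + (suc r + suc e) ≡ suc (r + suc (r + suc e))
      size = solve-∀
      IH₁ : suc (r + suc (suc e)) * B₁ ≡ suc (suc (suc e)) * c
      IH₁ = trans ih₁ (cong (λ z → suc (suc (suc e)) * (z C r)) (eq r e))
        where
        eq : ∀ r e → r + (r + suc (suc e)) ≡ r + suc (r + suc e)
        eq = solve-∀
      IH₂ : suc (suc r + e) * B₂ ≡ suc e * c′
      IH₂ = trans ih₂ (cong (λ z → suc e * (z C suc r)) (eq r e))
        where
        eq : ∀ r e → suc r + (suc r + e) ≡ r + suc (r + suc e)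
        eq = solve-∀
      c′≈c : suc r * c′ ≡ suc (r + suc e) * c
      c′≈c = +-cancelʳ-≡ (r * c) _ _ (trans ([k+1]*nC[k+1]+k*nCk≡n*nCk N r) (eq r e c))
        where
        eq : ∀ r e c → (r + suc (r + suc e)) * c ≡ suc (r + suc e) * c + r * c
        eq = solve-∀
      split : ∀ r e B₁ B₂ → suc r * suc (r + suc e) * (suc (suc r + suc e) * (B₁ + B₂))
        ≡ suc r * suc (r + suc e) * (suc (r + suc (suc e)) * B₁) + suc r * suc (suc r + suc e) * (suc (suc r + e) * B₂)
      split = solve-∀
      regroup : ∀ r e c c′ → suc r * suc (r + suc e) * (suc (suc (suc e)) * c) + suc r * suc (suc r + suc e) * (suc e * c′)
        ≡ suc r * suc (r + suc e) * (suc (suc (suc e)) * c) + suc (suc r + suc e) * suc e * (suc r * c′)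
      regroup = solve-∀
      balance : ∀ r e c → suc r * suc (r + suc e) * (suc (suc (suc e)) * c) + suc (suc r + suc e) * suc e * (suc (r + suc e) * c)
        ≡ suc r * suc (r + suc e) * (suc (suc e) * c) + suc (r + suc e) * suc (suc e) * (suc (r + suc e) * c)
      balance = solve-∀
      factor : ∀ r e c c′ → suc r * suc (r + suc e) * (suc (suc e) * c) + suc (r + suc e) * suc (suc e) * (suc r * c′)
        ≡ suc r * suc (r + suc e) * (suc (suc e) * (c + c′))
      factor = solve-∀

  ballot-ratio : ∀ p → (p + 3) * ballot p 2 ≡ 3 * (p + 1) * ballot p 1
  ballot-ratio p = *-cancelˡ-≡ _ _ (2 + p) (begin
    (2 + p) * ((p + 3) * ballot p 2)        ≡⟨ suc-form p (ballot p 2) ⟩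
    (2 + p) * (suc (p + 2) * ballot p 2)    ≡⟨ cong ((2 + p) *_) (ballot-closed p 2) ⟩
    (2 + p) * (3 * ((p + (p + 2)) C p))     ≡⟨ cong (λ z → (2 + p) * (3 * (z C p))) (size₂ p) ⟩
    (2 + p) * (3 * (suc M C p))             ≡⟨ swap p (suc M C p) ⟩
    3 * ((2 + p) * (suc M C p))             ≡⟨ cong (3 *_) key ⟩
    3 * (suc M * (M C p))                   ≡⟨ double p (M C p) ⟩
    3 * (p + 1) * (2 * (M C p))             ≡⟨ cong (λ z → 3 * (p + 1) * (2 * (z C p))) (sym (size₁ p)) ⟩
    3 * (p + 1) * (2 * ((p + (p + 1)) C p)) ≡⟨ cong (3 * (p + 1) *_) (sym (ballot-closed p 1)) ⟩
    3 * (p + 1) * (suc (p + 1) * ballot p 1) ≡⟨ regroup p (ballot p 1) ⟩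
    (2 + p) * (3 * (p + 1) * ballot p 1)    ∎)
    where
    open ≡-Reasoning
    M = p + suc p
    key : (2 + p) * (suc M C p) ≡ suc M * (M C p)
    key = +-cancelˡ-≡ (p * (suc M C p)) _ _ (begin
      p * (suc M C p) + (2 + p) * (suc M C p)   ≡⟨ collect p (suc M C p) ⟩
      suc M * (suc M C p)                       ≡⟨ sym ([n+1]*nCk+k*[n+1]Ck≡[n+1]*[n+1]Ck M p) ⟩
      suc M * (M C p) + p * (suc M C p)         ≡⟨ +-comm (suc M * (M C p)) _ ⟩
      p * (suc M C p) + suc M * (M C p)         ∎)
      where
      collect : ∀ p x → p * x + (2 + p) * x ≡ suc (p + suc p) * x
      collect = solve-∀
    size₁ : ∀ p → p + (p + 1) ≡ p + suc p
    size₁ = solve-∀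
    size₂ : ∀ p → p + (p + 2) ≡ suc (p + suc p)
    size₂ = solve-∀
    suc-form : ∀ p b → (2 + p) * ((p + 3) * b) ≡ (2 + p) * (suc (p + 2) * b)
    suc-form = solve-∀
    swap : ∀ p x → (2 + p) * (3 * x) ≡ 3 * ((2 + p) * x)
    swap = solve-∀
    double : ∀ p x → 3 * (suc (p + suc p) * x) ≡ 3 * (p + 1) * (2 * x)
    double = solve-∀
    regroup : ∀ p b → 3 * (p + 1) * (suc (p + 1) * b) ≡ (2 + p) * (3 * (p + 1) * b)
    regroup = solve-∀

module TopologicalSorts where

  open import Defs
  open import Data.Nat as ℕ using (ℕ; zero; suc; _+_)
  import Data.Nat.Properties as ℕ
  open import Data.Nat.ListAction using (sum)
  open import Data.Bool using (true; false)
  open import Data.Fin as Fin using (Fin; toℕ; opposite)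
  open import Data.Fin.Properties
    using (all?; any?; toℕ-injective; suc-injective; opposite-prop; opposite-involutive; toℕ<n; injective⇒≤)
    renaming (_≟_ to _≟ᶠ_)
  open import Data.List using (List; []; _∷_; map; concatMap; filter; length; _++_; allFin; lookup; tabulate)
  open import Data.List.Properties using (filter-≐; filter-++; filter-none; length-++; map-cong; map-tabulate)
  open import Data.List.Relation.Unary.Any as Any using (Any; here; there)
  import Data.List.Relation.Unary.Any.Properties as Any
  open import Data.List.Relation.Unary.All as All using (All; []; _∷_)
  import Data.List.Relation.Unary.All.Properties as All
  open import Data.List.Relation.Unary.AllPairs as AllPairs using (AllPairs; []; _∷_)
  import Data.List.Relation.Unary.AllPairs.Properties as AllPairs
  open import Data.List.Membership.Propositional using (_∈_)
  open import Data.List.Membership.Propositional.Properties using (∈-lookup; ∈-allFin)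
  import Data.List.Membership.DecPropositional as DecMembership
  open import Data.Product using (_×_; _,_; ∃; proj₁; proj₂)
  open import Data.Empty using (⊥-elim)
  open import Data.Vec.Functional using () renaming (_∷_ to _∷ᵥ_)
  open import Function using (_∘_; case_of_)
  open import Relation.Binary.PropositionalEquality
  open import Data.Unit using (⊤; tt)
  open import Relation.Nullary using (yes; no; ¬_; _×-dec_; _→-dec_; does)
  open import Relation.Unary using (Decidable)

  private variable
    A B : Set

  count : {P : A → Set} → Decidable P → List A → ℕ
  count P? xs = length (filter P? xs)

  module _ {P : A → Set} (P? : Decidable P) where

    count-++ : ∀ xs ys → count P? (xs ++ ys) ≡ count P? xs + count P? ys
    count-++ xs ys = trans (cong length (filter-++ P? xs ys)) (length-++ (filter P? xs))

    count-map : (h : B → A) (xs : List B) → count P? (map h xs) ≡ count (P? ∘ h) xs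
    count-map h []       = refl
    count-map h (x ∷ xs) with does (P? (h x))
    ... | true  = cong suc (count-map h xs)
    ... | false = count-map h xs

    count-concatMap : (F : B → List A) (xs : List B) →
                      count P? (concatMap F xs) ≡ sum (map (count P? ∘ F) xs)
    count-concatMap F []       = refl
    count-concatMap F (x ∷ xs) =
      trans (count-++ (F x) (concatMap F xs)) (cong (count P? (F x) +_) (count-concatMap F xs))

    count-none : (∀ x → ¬ P x) → ∀ xs → count P? xs ≡ 0
    count-none ¬P xs = cong length (filter-none P? (All.universal ¬P xs))

    Any-filter⁺ : {R : A → Set} → (∀ {x} → R x → P x) → ∀ {xs} → Any R xs → Any R (filter P? xs)
    Any-filter⁺ R⊆P {x ∷ xs} (here r) with P? x
    ... | yes _  = here r
    ... | no ¬Px = ⊥-elim (¬Px (R⊆P r))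
    Any-filter⁺ R⊆P {x ∷ xs} (there r) with does (P? x)
    ... | true  = there (Any-filter⁺ R⊆P r)
    ... | false = Any-filter⁺ R⊆P r

  count-singleton : {P : A → Set} (P? : Decidable P) {x : A} → P x → count P? (x ∷ []) ≡ 1
  count-singleton P? {x} Px with P? x
  ... | yes _  = refl
  ... | no ¬Px = ⊥-elim (¬Px Px)

  count-≐ : {P Q : A → Set} (P? : Decidable P) (Q? : Decidable Q) →
            (∀ x → P x → Q x) → (∀ x → Q x → P x) → ∀ xs → count P? xs ≡ count Q? xs
  count-≐ P? Q? P⇒Q Q⇒P xs = cong length (filter-≐ P? Q? ((λ {x} → P⇒Q x) , (λ {x} → Q⇒P x)) xs)

  AllPairs-lookup-injective : {R : A → A → Set} → (∀ {a b} → R a b → R b a) →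
    ∀ {xs} → AllPairs (λ a b → ¬ R a b) xs → ∀ i j → R (lookup xs i) (lookup xs j) → i ≡ j
  AllPairs-lookup-injective sym (_ ∷ _) Fin.zero Fin.zero r = refl
  AllPairs-lookup-injective sym (a ∷ _) Fin.zero (Fin.suc j) r = ⊥-elim (All.lookup a (∈-lookup j) r)
  AllPairs-lookup-injective sym (a ∷ _) (Fin.suc i) Fin.zero r = ⊥-elim (All.lookup a (∈-lookup i) (sym r))
  AllPairs-lookup-injective sym (_ ∷ d) (Fin.suc i) (Fin.suc j) r =
    cong Fin.suc (AllPairs-lookup-injective sym d i j r)

  _≗ᶠ_ : ∀ {m k} → (Fin m → Fin k) → (Fin m → Fin k) → Set
  g ≗ᶠ h = ∀ i → g i ≡ h i

  allFuns-complete : ∀ m k (f : Fin m → Fin k) → Any (_≗ᶠ f) (allFuns m k)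
  allFuns-complete zero    k f = here (λ ())
  allFuns-complete (suc m) k f =
    Any.concat⁺ (Any.map⁺ (Any.map (λ { refl → Any.map⁺ (Any.map extend (allFuns-complete m k (f ∘ Fin.suc))) })
                                   (∈-allFin (f Fin.zero))))
    where
    extend : ∀ {g} → g ≗ᶠ (f ∘ Fin.suc) → (f Fin.zero ∷ᵥ g) ≗ᶠ f
    extend g≗ Fin.zero    = refl
    extend g≗ (Fin.suc i) = g≗ i

  allFuns-unique : ∀ m k → AllPairs (λ g h → ¬ g ≗ᶠ h) (allFuns m k)
  allFuns-unique zero    k = [] ∷ []
  allFuns-unique (suc m) k = AllPairs.concat⁺
    (All.map⁺ (All.universal (λ y → AllPairs.map⁺ (AllPairs.map (λ g≉h g≗h → g≉h (g≗h ∘ Fin.suc)) (allFuns-unique m k))) _))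
    (AllPairs.map⁺ (AllPairs.tabulate⁺ {f = λ y → y} (λ y≢y′ →
      All.map⁺ (All.universal (λ g → All.map⁺ (All.universal (λ h e → y≢y′ (e Fin.zero)) _)) _))))

  module _ {m k m′ k′} {P : (Fin m → Fin k) → Set} {Q : (Fin m′ → Fin k′) → Set}
           (P? : Decidable P) (Q? : Decidable Q) where

    count-≤-injection : (φ : (Fin m → Fin k) → (Fin m′ → Fin k′)) →
      (∀ f → P f → Q (φ f)) → (∀ g g′ → g′ ≗ᶠ g → Q g → Q g′) →
      (∀ f f′ → P f → P f′ → φ f ≗ᶠ φ f′ → f ≗ᶠ f′) →
      count P? (allFuns m k) ℕ.≤ count Q? (allFuns m′ k′)
    count-≤-injection φ P⇒Qφ Q-resp φ-injective = injective⇒≤ {f = position} position-injective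
      where
      fs = filter P? (allFuns m k)
      gs = filter Q? (allFuns m′ k′)
      P-fs : ∀ i → P (lookup fs i)
      P-fs i = All.lookup (All.all-filter P? (allFuns m k)) (∈-lookup i)
      found : ∀ i → Any (_≗ᶠ φ (lookup fs i)) gs
      found i = Any-filter⁺ Q? (λ {g} g≗ → Q-resp _ g g≗ (P⇒Qφ _ (P-fs i))) (allFuns-complete m′ k′ (φ (lookup fs i)))
      position : Fin (length fs) → Fin (length gs)
      position i = Any.index (found i)
      position-injective : ∀ {i j} → position i ≡ position j → i ≡ j
      position-injective {i} {j} eq =
        AllPairs-lookup-injective (λ e x → sym (e x)) (AllPairs.filter⁺ P? (allFuns-unique m k)) i j
          (φ-injective _ _ (P-fs i) (P-fs j) (λ x →
            trans (sym (Any.lookup-index (found i) x))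
                  (trans (cong (λ p → lookup gs p x) eq) (Any.lookup-index (found j) x))))

  VertexSet : Set₁
  VertexSet = ℕ → Set

  _∖_ : VertexSet → ℕ → VertexSet
  (S ∖ y) x = S x × x ≢ y

  ∖-≡ : ∀ {S y y′ x} → y ≡ y′ → (S ∖ y) x → (S ∖ y′) x
  ∖-≡ refl x∈ = x∈

  module _ (G : Digraph) where

    private
      Arc : Fin (N G) → Fin (N G) → Set
      Arc w w′ = (toℕ w , toℕ w′) ∈ arcs G

    IsTopSort : VertexSet → (m : ℕ) → (Fin m → Fin (N G)) → Set
    IsTopSort S m g =
      (∀ j → S (toℕ (g j))) ×
      (∀ j j′ → g j ≡ g j′ → j ≡ j′) ×
      (∀ w → S (toℕ w) → ∃ λ j → g j ≡ w) ×
      (∀ j j′ → Arc (g j) (g j′) → j Fin.< j′)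

    isTopSort? : ∀ {S} → Decidable S → ∀ m → Decidable (IsTopSort S m)
    isTopSort? S? m g =
      all? (λ j → S? (toℕ (g j))) ×-dec
      all? (λ j → all? (λ j′ → (g j ≟ᶠ g j′) →-dec (j ≟ᶠ j′))) ×-dec
      all? (λ w → S? (toℕ w) →-dec any? (λ j → g j ≟ᶠ w)) ×-dec
      all? (λ j → all? (λ j′ → ((toℕ (g j) , toℕ (g j′)) ∈? arcs G) →-dec (j Fin.<? j′)))
      where open DecMembership _≟ℕ²_ using (_∈?_)

    #topSorts : ∀ {S} → Decidable S → ℕ → ℕ
    #topSorts S? m = count (isTopSort? S? m) (allFuns m (N G))

    IsSource : VertexSet → Fin (N G) → Set
    IsSource S y = S (toℕ y) × (∀ w → S (toℕ w) → ¬ Arc w y)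

    IsTopSort-≐ : ∀ {S S′} → (∀ w → S (toℕ w) → S′ (toℕ w)) → (∀ w → S′ (toℕ w) → S (toℕ w)) →
                  ∀ {m} g → IsTopSort S m g → IsTopSort S′ m g
    IsTopSort-≐ S⇒S′ S′⇒S g (inS , injective , onto , forward) =
      (λ j → S⇒S′ _ (inS j)) , injective , (λ w w∈S′ → onto w (S′⇒S w w∈S′)) , forward

    #topSorts-≐ : ∀ {S S′} (S? : Decidable S) (S′? : Decidable S′) →
                  (∀ w → S (toℕ w) → S′ (toℕ w)) → (∀ w → S′ (toℕ w) → S (toℕ w)) →
                  ∀ m → #topSorts S? m ≡ #topSorts S′? m
    #topSorts-≐ {S} {S′} S? S′? S⇒S′ S′⇒S m =
      count-≐ (isTopSort? S? m) (isTopSort? S′? m)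
              (IsTopSort-≐ {S} {S′} S⇒S′ S′⇒S) (IsTopSort-≐ {S′} {S} S′⇒S S⇒S′) (allFuns m (N G))

    IsTopSort-∷⁻ : ∀ S m y g → IsTopSort S (suc m) (y ∷ᵥ g) → IsSource S y × IsTopSort (S ∖ toℕ y) m g
    IsTopSort-∷⁻ S m y g (inS , injective , onto , forward) =
      (inS Fin.zero , noArcIn) , (inS′ , injective′ , onto′ , forward′)
      where
      noArcIn : ∀ w → S (toℕ w) → ¬ Arc w y
      noArcIn w w∈S arc with onto w w∈S
      ... | j , refl with forward j Fin.zero arc
      ... | ()
      inS′ : ∀ j → (S ∖ toℕ y) (toℕ (g j))
      inS′ j = inS (Fin.suc j) , λ gj≡y → case injective (Fin.suc j) Fin.zero (toℕ-injective gj≡y) of λ ()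
      injective′ : ∀ j j′ → g j ≡ g j′ → j ≡ j′
      injective′ j j′ e = suc-injective (injective (Fin.suc j) (Fin.suc j′) e)
      onto′ : ∀ w → (S ∖ toℕ y) (toℕ w) → ∃ λ j → g j ≡ w
      onto′ w (w∈S , w≢y) with onto w w∈S
      ... | Fin.suc j , gj≡w = j , gj≡w
      ... | Fin.zero  , refl = ⊥-elim (w≢y refl)
      forward′ : ∀ j j′ → Arc (g j) (g j′) → j Fin.< j′
      forward′ j j′ arc = ℕ.≤-pred (forward (Fin.suc j) (Fin.suc j′) arc)

    IsTopSort-∷⁺ : ∀ S m y g → IsSource S y → IsTopSort (S ∖ toℕ y) m g → IsTopSort S (suc m) (y ∷ᵥ g)
    IsTopSort-∷⁺ S m y g (y∈S , noArcIn) (inS′ , injective′ , onto′ , forward′) =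
      inS , injective , onto , forward
      where
      g≢y : ∀ j → g j ≢ y
      g≢y j gj≡y = proj₂ (inS′ j) (cong toℕ gj≡y)
      inS : ∀ j → S (toℕ ((y ∷ᵥ g) j))
      inS Fin.zero    = y∈S
      inS (Fin.suc j) = proj₁ (inS′ j)
      injective : ∀ j j′ → (y ∷ᵥ g) j ≡ (y ∷ᵥ g) j′ → j ≡ j′
      injective Fin.zero    Fin.zero     e = refl
      injective Fin.zero    (Fin.suc j′) e = ⊥-elim (g≢y j′ (sym e))
      injective (Fin.suc j) Fin.zero     e = ⊥-elim (g≢y j e)
      injective (Fin.suc j) (Fin.suc j′) e = cong Fin.suc (injective′ j j′ e)
      onto : ∀ w → S (toℕ w) → ∃ λ j → (y ∷ᵥ g) j ≡ w
      onto w w∈S with w ≟ᶠ y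
      ... | yes refl = Fin.zero , refl
      ... | no w≢y with onto′ w (w∈S , w≢y ∘ toℕ-injective)
      ...   | j , gj≡w = Fin.suc j , gj≡w
      forward : ∀ j j′ → Arc ((y ∷ᵥ g) j) ((y ∷ᵥ g) j′) → j Fin.< j′
      forward j           Fin.zero     arc = ⊥-elim (noArcIn _ (inS j) arc)
      forward Fin.zero    (Fin.suc j′) arc = ℕ.s≤s ℕ.z≤n
      forward (Fin.suc j) (Fin.suc j′) arc = ℕ.s≤s (forward′ j j′ arc)

    firsts : ∀ {S} → Decidable S → ℕ → Fin (N G) → ℕ
    firsts S? m y = count (λ g → isTopSort? S? (suc m) (y ∷ᵥ g)) (allFuns m (N G))

    #topSorts-suc : ∀ {S} (S? : Decidable S) m → #topSorts S? (suc m) ≡ sum (tabulate (firsts S? m))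
    #topSorts-suc S? m = begin
      #topSorts S? (suc m)
        ≡⟨ count-concatMap (isTopSort? S? (suc m)) block (allFin (N G)) ⟩
      sum (map (count (isTopSort? S? (suc m)) ∘ block) (allFin (N G)))
        ≡⟨ cong sum (map-cong (λ y → count-map (isTopSort? S? (suc m)) (y ∷ᵥ_) (allFuns m (N G))) (allFin (N G))) ⟩
      sum (map (firsts S? m) (allFin (N G)))
        ≡⟨ cong sum (map-tabulate (λ y → y) (firsts S? m)) ⟩
      sum (tabulate (firsts S? m)) ∎
      where
      open ≡-Reasoning
      block : Fin (N G) → List (Fin (suc m) → Fin (N G))
      block y = map (y ∷ᵥ_) (allFuns m (N G))

    firsts-source : ∀ {S S′} (S? : Decidable S) (S′? : Decidable S′) m y → IsSource S y →
      (∀ x → (S ∖ toℕ y) x → S′ x) → (∀ x → S′ x → (S ∖ toℕ y) x) → firsts S? m y ≡ #topSorts S′? m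
    firsts-source {S} {S′} S? S′? m y source ⇒ ⇐ =
      count-≐ (λ g → isTopSort? S? (suc m) (y ∷ᵥ g)) (isTopSort? S′? m)
        (λ g sort → IsTopSort-≐ {S ∖ toℕ y} {S′} (⇒ ∘ toℕ) (⇐ ∘ toℕ) g (proj₂ (IsTopSort-∷⁻ S m y g sort)))
        (λ g sort → IsTopSort-∷⁺ S m y g source (IsTopSort-≐ {S′} {S ∖ toℕ y} (⇐ ∘ toℕ) (⇒ ∘ toℕ) g sort))
        (allFuns m (N G))

    firsts-nonSource : ∀ {S} (S? : Decidable S) m y → ¬ IsSource S y → firsts S? m y ≡ 0
    firsts-nonSource {S} S? m y ¬source =
      count-none (λ g → isTopSort? S? (suc m) (y ∷ᵥ g)) (λ g sort → ¬source (proj₁ (IsTopSort-∷⁻ S m y g sort)))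
        (allFuns m (N G))

  preimage : ∀ {n} → (Fin n → Fin n) → Fin n → Fin n
  preimage f y with any? (λ x → f x ≟ᶠ y)
  ... | yes (x , _) = x
  ... | no _        = y

  preimage-spec : ∀ {n} (f : Fin n → Fin n) y → (∃ λ x → f x ≡ y) → f (preimage f y) ≡ y
  preimage-spec f y y∈im with any? (λ x → f x ≟ᶠ y)
  ... | yes (x , fx≡y) = fx≡y
  ... | no y∉im        = ⊥-elim (y∉im y∈im)

  preimage-image : ∀ {n} (f : Fin n → Fin n) → (∀ x y → f x ≡ f y → x ≡ y) → ∀ w → preimage f (f w) ≡ w
  preimage-image f injective w = injective _ _ (preimage-spec f (f w) (w , refl))

  opposite-injective : ∀ {n} {i j : Fin n} → opposite i ≡ opposite j → i ≡ j
  opposite-injective {i = i} {j} e = trans (sym (opposite-involutive i)) (trans (cong opposite e) (opposite-involutive j))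

  opposite-< : ∀ {n} {i j : Fin n} → i Fin.< j → opposite j Fin.< opposite i
  opposite-< {i = i} {j} i<j rewrite opposite-prop i | opposite-prop j = ℕ.∸-monoʳ-< (ℕ.s≤s i<j) (toℕ<n j)

  opposite-<⁻ : ∀ {n} {i j : Fin n} → opposite j Fin.< opposite i → i Fin.< j
  opposite-<⁻ {i = i} {j} lt = subst₂ Fin._<_ (opposite-involutive i) (opposite-involutive j) (opposite-< lt)

  module _ (G : Digraph) where

    private
      n = N G
      everything? : Decidable {A = ℕ} (λ _ → ⊤)
      everything? _ = yes tt

    -- A disposition f lists the vertices by decreasing label: j ↦ f⁻¹ (n - 1 - j).
    listing : (Fin n → Fin n) → (Fin n → Fin n)
    listing f j = preimage f (opposite j)

    labelling : (Fin n → Fin n) → (Fin n → Fin n)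
    labelling g w = opposite (preimage g w)

    listing-sort : ∀ f → IsDisposition G f → IsTopSort G (λ _ → ⊤) n (listing f)
    listing-sort f ((injective , onto) , descending) = (λ _ → tt) , injective′ , onto′ , forward
      where
      f∘listing : ∀ j → f (listing f j) ≡ opposite j
      f∘listing j = preimage-spec f (opposite j) (onto (opposite j))
      injective′ : ∀ j j′ → listing f j ≡ listing f j′ → j ≡ j′
      injective′ j j′ e = opposite-injective (trans (sym (f∘listing j)) (trans (cong f e) (f∘listing j′)))
      onto′ : ∀ w → ⊤ → ∃ λ j → listing f j ≡ w
      onto′ w _ = opposite (f w) , trans (cong (preimage f) (opposite-involutive (f w))) (preimage-image f injective w)
      forward : ∀ j j′ → (toℕ (listing f j) , toℕ (listing f j′)) ∈ arcs G → j Fin.< j′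
      forward j j′ arc = opposite-<⁻ (subst₂ Fin._<_ (f∘listing j′) (f∘listing j) (descending _ _ arc))

    labelling-disposition : ∀ g → IsTopSort G (λ _ → ⊤) n g → IsDisposition G (labelling g)
    labelling-disposition g (_ , injective , onto , forward) = (injective′ , onto′) , descending
      where
      g∘preimage : ∀ w → g (preimage g w) ≡ w
      g∘preimage w = preimage-spec g w (onto w tt)
      injective′ : ∀ x y → labelling g x ≡ labelling g y → x ≡ y
      injective′ x y e = trans (sym (g∘preimage x)) (trans (cong g (opposite-injective e)) (g∘preimage y))
      onto′ : ∀ y → ∃ λ x → labelling g x ≡ y
      onto′ y = g (opposite y) , trans (cong opposite (preimage-image g injective (opposite y))) (opposite-involutive y)
      descending : ∀ a b → (toℕ a , toℕ b) ∈ arcs G → labelling g b Fin.< labelling g a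
      descending a b arc = opposite-< (forward _ _ (subst₂ (λ u v → (toℕ u , toℕ v) ∈ arcs G) (sym (g∘preimage a)) (sym (g∘preimage b)) arc))

    listing-injective : ∀ f f′ → IsDisposition G f → IsDisposition G f′ → listing f ≗ᶠ listing f′ → f ≗ᶠ f′
    listing-injective f f′ ((injective , _) , _) ((_ , onto′) , _) e w =
      sym (trans (cong f′ (sym same)) (preimage-spec f′ (f w) (onto′ (f w))))
      where
      same : preimage f′ (f w) ≡ w
      same = trans (sym (cong (preimage f′) (opposite-involutive (f w))))
                   (trans (sym (e (opposite (f w))))
                          (trans (cong (preimage f) (opposite-involutive (f w))) (preimage-image f injective w)))

    labelling-injective : ∀ g g′ → IsTopSort G (λ _ → ⊤) n g → IsTopSort G (λ _ → ⊤) n g′ →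
                          labelling g ≗ᶠ labelling g′ → g ≗ᶠ g′
    labelling-injective g g′ (_ , injective , _) (_ , _ , onto′ , _) e j =
      sym (trans (cong g′ same) (preimage-spec g′ (g j) (onto′ (g j) tt)))
      where
      same : j ≡ preimage g′ (g j)
      same = opposite-injective (trans (cong opposite (sym (preimage-image g injective j))) (e (g j)))

    disposition-≗ : ∀ f f′ → f′ ≗ᶠ f → IsDisposition G f → IsDisposition G f′
    disposition-≗ f f′ e ((injective , onto) , descending) =
      ((λ x y q → injective x y (trans (sym (e x)) (trans q (e y)))) ,
       (λ y → proj₁ (onto y) , trans (e _) (proj₂ (onto y)))) ,
      (λ a b arc → subst₂ Fin._<_ (sym (e b)) (sym (e a)) (descending a b arc))

    topSort-≗ : ∀ g g′ → g′ ≗ᶠ g → IsTopSort G (λ _ → ⊤) n g → IsTopSort G (λ _ → ⊤) n g′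
    topSort-≗ g g′ e (_ , injective , onto , forward) =
      (λ _ → tt) ,
      (λ j j′ q → injective j j′ (trans (sym (e j)) (trans q (e j′)))) ,
      (λ w _ → proj₁ (onto w tt) , trans (e _) (proj₂ (onto w tt))) ,
      (λ j j′ arc → forward j j′ (subst₂ (λ u v → (toℕ u , toℕ v) ∈ arcs G) (e j) (e j′) arc))

    σ≡#topSorts : σ G ≡ #topSorts G everything? n
    σ≡#topSorts = ℕ.≤-antisym
      (count-≤-injection (isDisposition? G) (isTopSort? G everything? n) listing listing-sort topSort-≗ listing-injective)
      (count-≤-injection (isTopSort? G everything? n) (isDisposition? G) labelling labelling-disposition disposition-≗ labelling-injective)

module LadderDigraph where

  open import Defs
  open import Data.Nat as ℕ using (ℕ; zero; suc; _+_; _∸_; _<_; s≤s; z≤n)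
  import Data.Nat.Properties as ℕ
  open import Data.List using (map; upTo)
  open import Data.List.Relation.Unary.Any using (here; there)
  open import Data.List.Membership.Propositional using (_∈_)
  open import Data.List.Membership.Propositional.Properties using (∈-map⁺; ∈-map⁻; ∈-++⁺ˡ; ∈-++⁺ʳ; ∈-++⁻; ∈-upTo⁺; ∈-upTo⁻)
  open import Data.Product using (_×_; _,_; ∃)
  open import Data.Sum using (_⊎_; inj₁; inj₂)
  open import Relation.Binary.PropositionalEquality

  ladder : ℕ → ℕ → Digraph
  ladder n i = attachTail (Gnn n) 1 i

  data Arc (n i : ℕ) : ℕ → ℕ → Set where
    vv : ∀ j → suc j < n → Arc n i j (suc j)
    uu : ∀ j → suc j < n → Arc n i (n + j) (n + suc j)
    vu : ∀ j → j < n → Arc n i j (n + j)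
    vz : 0 < i → Arc n i 1 (n + n)
    zz : ∀ k → suc k < i → Arc n i (n + n + k) (n + n + suc k)

  private
    <∸1⇒ : ∀ {k n} → k < n ∸ 1 → suc k < n
    <∸1⇒ {n = suc n} k<n-1 = s≤s k<n-1

    ⇒<∸1 : ∀ {k n} → suc k < n → k < n ∸ 1
    ⇒<∸1 {n = suc n} (s≤s k<n-1) = k<n-1

    tailArcs⁻ : ∀ v base i {x y} → (x , y) ∈ tailArcs v base i →
      (0 < i × x ≡ v × y ≡ base) ⊎ (∃ λ k → suc k < i × x ≡ base + k × y ≡ base + suc k)
    tailArcs⁻ v base (suc i) (here refl) = inj₁ (s≤s z≤n , refl , refl)
    tailArcs⁻ v base (suc i) (there arc) with tailArcs⁻ base (suc base) i arc
    ... | inj₁ (0<i , refl , refl) = inj₂ (0 , s≤s 0<i , sym (ℕ.+-identityʳ base) , sym (ℕ.+-suc base 0 ∙ cong suc (ℕ.+-identityʳ base)))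
      where _∙_ = trans
    ... | inj₂ (k , k<i , refl , refl) = inj₂ (suc k , s≤s k<i , sym (ℕ.+-suc base k) , sym (ℕ.+-suc base (suc k)))

    tailArcs⁺ : ∀ v base i k → suc k < i → (base + k , base + suc k) ∈ tailArcs v base i
    tailArcs⁺ v base (suc (suc i)) zero (s≤s k<i) =
      there (subst₂ (λ x y → (x , y) ∈ tailArcs base (suc base) (suc i))
                    (sym (ℕ.+-identityʳ base)) (sym (trans (ℕ.+-suc base 0) (cong suc (ℕ.+-identityʳ base))))
                    (here refl))
    tailArcs⁺ v base (suc i) (suc k) (s≤s k<i) =
      there (subst₂ (λ x y → (x , y) ∈ tailArcs base (suc base) i) (sym (ℕ.+-suc base k)) (sym (ℕ.+-suc base (suc k)))
                    (tailArcs⁺ base (suc base) i k k<i))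

  arc⁻ : ∀ n i {x y} → (x , y) ∈ arcs (ladder n i) → Arc n i x y
  arc⁻ n i arc with ∈-++⁻ (arcsGnn n) arc
  ... | inj₂ t with tailArcs⁻ 1 (n + n) i t
  ...   | inj₁ (0<i , refl , refl)       = vz 0<i
  ...   | inj₂ (k , k<i , refl , refl)   = zz k k<i
  arc⁻ n i arc | inj₁ g with ∈-++⁻ (map (λ k → (k , suc k)) (upTo (n ∸ 1))) g
  ... | inj₁ a with ∈-map⁻ (λ k → (k , suc k)) a
  ...   | j , j∈ , refl = vv j (<∸1⇒ (∈-upTo⁻ j∈))
  arc⁻ n i arc | inj₁ g | inj₂ b with ∈-++⁻ (map (λ k → (n + k , n + suc k)) (upTo (n ∸ 1))) b
  ... | inj₁ c with ∈-map⁻ (λ k → (n + k , n + suc k)) c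
  ...   | j , j∈ , refl = uu j (<∸1⇒ (∈-upTo⁻ j∈))
  arc⁻ n i arc | inj₁ g | inj₂ b | inj₂ c with ∈-map⁻ (λ k → (k , n + k)) c
  ... | j , j∈ , refl = vu j (∈-upTo⁻ j∈)

  arc⁺ : ∀ n i {x y} → Arc n i x y → (x , y) ∈ arcs (ladder n i)
  arc⁺ n i (vv j j<n) = ∈-++⁺ˡ (∈-++⁺ˡ (∈-map⁺ (λ k → (k , suc k)) (∈-upTo⁺ (⇒<∸1 j<n))))
  arc⁺ n i (uu j j<n) = ∈-++⁺ˡ (∈-++⁺ʳ (map (λ k → (k , suc k)) (upTo (n ∸ 1)))
                          (∈-++⁺ˡ (∈-map⁺ (λ k → (n + k , n + suc k)) (∈-upTo⁺ (⇒<∸1 j<n)))))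
  arc⁺ n i (vu j j<n) = ∈-++⁺ˡ (∈-++⁺ʳ (map (λ k → (k , suc k)) (upTo (n ∸ 1)))
                          (∈-++⁺ʳ (map (λ k → (n + k , n + suc k)) (upTo (n ∸ 1))) (∈-map⁺ (λ k → (k , n + k)) (∈-upTo⁺ j<n))))
  arc⁺ n i (vz 0<i)   = ∈-++⁺ʳ (arcsGnn n) (here′ 0<i)
    where
    here′ : ∀ {i} → 0 < i → (1 , n + n) ∈ tailArcs 1 (n + n) i
    here′ {suc i} _ = here refl
  arc⁺ n i (zz k k<i) = ∈-++⁺ʳ (arcsGnn n) (tailArcs⁺ 1 (n + n) i k k<i)

module LadderSorts where

  open import Defs
  open import Data.Nat as ℕ using (ℕ; zero; suc; _+_; _∸_; _<_; _≤_; s≤s; z≤n; _≟_; _≤?_; _<?_)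
  import Data.Nat.Properties as ℕ
  open import Data.Nat.ListAction using (sum)
  open import Data.Fin as Fin using (Fin; toℕ; fromℕ<)
  open import Data.Fin.Properties using (toℕ<n; toℕ-fromℕ<)
  open import Data.List using (tabulate)
  open import Data.List.Properties using (tabulate-cong)
  open import Data.Product using (_×_; _,_; ∃; proj₁; proj₂)
  open import Data.Sum using (_⊎_; inj₁; inj₂)
  open import Data.Empty using (⊥; ⊥-elim)
  open import Function using (_∘_)
  open import Relation.Binary.PropositionalEquality
  open import Relation.Nullary using (Dec; yes; no; ¬_; _×-dec_; _⊎-dec_; does)
  open import Relation.Unary using (Decidable)
  open import Data.Bool using (if_then_else_)
  open import Data.Nat.Tactic.RingSolver using (solve-∀)
  open TopologicalSorts
  open LadderDigraph

  when : {P : Set} → Dec P → ℕ → ℕ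
  when P? v = if does P? then v else 0

  point : ℕ → ℕ → ℕ → ℕ
  point x v y = when (y ≟ x) v

  when-yes : {P : Set} (P? : Dec P) {v : ℕ} → P → when P? v ≡ v
  when-yes (yes _) _ = refl
  when-yes (no ¬p) p = ⊥-elim (¬p p)

  when-no : {P : Set} (P? : Dec P) {v : ℕ} → ¬ P → when P? v ≡ 0
  when-no (yes p) ¬p = ⊥-elim (¬p p)
  when-no (no _)  _  = refl

  when-0 : {P : Set} (P? : Dec P) → when P? 0 ≡ 0
  when-0 (yes _) = refl
  when-0 (no _)  = refl

  point-here : ∀ x v → point x v x ≡ v
  point-here x v = when-yes (x ≟ x) refl

  point-elsewhere : ∀ x v {y} → y ≢ x → point x v y ≡ 0
  point-elsewhere x v {y} = when-no (y ≟ x)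

  sum-tabulate-+ : ∀ {N} (f g : Fin N → ℕ) → sum (tabulate (λ y → f y + g y)) ≡ sum (tabulate f) + sum (tabulate g)
  sum-tabulate-+ {zero}  f g = refl
  sum-tabulate-+ {suc N} f g =
    trans (cong (f Fin.zero + g Fin.zero +_) (sum-tabulate-+ (f ∘ Fin.suc) (g ∘ Fin.suc)))
          (interchange (f Fin.zero) (g Fin.zero) _ _)
    where
    interchange : ∀ a b c d → a + b + (c + d) ≡ a + c + (b + d)
    interchange = solve-∀

  sum-tabulate-0 : ∀ {N} (f : Fin N → ℕ) → (∀ y → f y ≡ 0) → sum (tabulate f) ≡ 0
  sum-tabulate-0 {zero}  f f≡0 = refl
  sum-tabulate-0 {suc N} f f≡0 = cong₂ _+_ (f≡0 Fin.zero) (sum-tabulate-0 (f ∘ Fin.suc) (f≡0 ∘ Fin.suc))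

  sum-tabulate-point : ∀ {N} x v → x < N → sum (tabulate (λ (y : Fin N) → point x v (toℕ y))) ≡ v
  sum-tabulate-point {suc N} zero    v _ =
    trans (cong (v +_) (sum-tabulate-0 {N} (λ y → point 0 v (suc (toℕ y))) (λ y → point-elsewhere 0 v {suc (toℕ y)} λ ()))) (ℕ.+-identityʳ v)
  sum-tabulate-point {suc N} (suc x) v (s≤s x<N) =
    sum-tabulate-point x v x<N

  sum-tabulate-point-when : ∀ {N} {P : Set} (P? : Dec P) x v → (P → x < N) →
                         sum (tabulate (λ (y : Fin N) → point x (when P? v) (toℕ y))) ≡ when P? v
  sum-tabulate-point-when (yes p) x v x<N = sum-tabulate-point x v (x<N p)
  sum-tabulate-point-when {N} (no _) x v _ = sum-tabulate-0 {N} (λ y → point x 0 (toℕ y)) (λ y → when-0 (toℕ y ≟ x))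

  point-when-elsewhere : ∀ {P : Set} (P? : Dec P) x v {y} → (P → y ≢ x) → point x (when P? v) y ≡ 0
  point-when-elsewhere (yes p) x v y≢x = point-elsewhere x v (y≢x p)
  point-when-elsewhere (no _)  x v {y} _ = when-0 (y ≟ x)

  module LadderStates (n i : ℕ) (2≤n : 2 ≤ n) where

    G = ladder n i

    -- The vertices v_{a+1}, …, v_n, u_{b+1}, …, u_n and z_{c+1}, …, z_i.
    Remaining : ℕ → ℕ → ℕ → VertexSet
    Remaining a b c x = (a ≤ x × x < n) ⊎ (n + b ≤ x × x < n + n) ⊎ (n + n + c ≤ x × x < n + n + i)

    remaining? : ∀ a b c → Decidable (Remaining a b c)
    remaining? a b c x =
      ((a ≤? x) ×-dec (x <? n)) ⊎-dec ((n + b ≤? x) ×-dec (x <? n + n)) ⊎-dec ((n + n + c ≤? x) ×-dec (x <? n + n + i))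

    #R : ℕ → ℕ → ℕ → ℕ → ℕ
    #R a b c = #topSorts G (remaining? a b c)

    data Region : ℕ → Set where
      v : ∀ j → j < n → Region j
      u : ∀ j → j < n → Region (n + j)
      z : ∀ k → k < i → Region (n + n + k)

    region : ∀ x → x < n + n + i → Region x
    region x x<N with x <? n
    ... | yes x<n = v x x<n
    ... | no x≮n with x ∸ n <? n
    ...   | yes x-n<n = subst Region (ℕ.m+[n∸m]≡n (ℕ.≮⇒≥ x≮n)) (u (x ∸ n) x-n<n)
    ...   | no x-n≮n = subst Region x≡ (z (x ∸ n ∸ n) (ℕ.+-cancelˡ-< (n + n) _ _ (subst (_< n + n + i) (sym x≡) x<N)))
      where
      x≡ : n + n + (x ∸ n ∸ n) ≡ x
      x≡ = trans (ℕ.+-assoc n n _) (trans (cong (n +_) (ℕ.m+[n∸m]≡n (ℕ.≮⇒≥ x-n≮n))) (ℕ.m+[n∸m]≡n (ℕ.≮⇒≥ x≮n)))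

    private
      n≤n+ : ∀ x → n ≤ n + x
      n≤n+ = ℕ.m≤m+n n
      n≤n+n+ : ∀ x → n ≤ n + n + x
      n≤n+n+ x = ℕ.≤-trans (n≤n+ n) (ℕ.m≤m+n (n + n) x)

    module _ {a b c : ℕ} where

      ∈R-v⁻ : ∀ {j} → j < n → Remaining a b c j → a ≤ j
      ∈R-v⁻ j<n (inj₁ (a≤j , _))         = a≤j
      ∈R-v⁻ j<n (inj₂ (inj₁ (n+b≤j , _))) = ⊥-elim (ℕ.<⇒≱ j<n (ℕ.≤-trans (n≤n+ b) n+b≤j))
      ∈R-v⁻ j<n (inj₂ (inj₂ (≤j , _)))     = ⊥-elim (ℕ.<⇒≱ j<n (ℕ.≤-trans (n≤n+n+ c) ≤j))

      ∈R-u⁻ : ∀ {j} → j < n → Remaining a b c (n + j) → b ≤ j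
      ∈R-u⁻ {j} j<n (inj₁ (_ , n+j<n))    = ⊥-elim (ℕ.<⇒≱ n+j<n (n≤n+ j))
      ∈R-u⁻ j<n (inj₂ (inj₁ (n+b≤ , _)))  = ℕ.+-cancelˡ-≤ n _ _ n+b≤
      ∈R-u⁻ j<n (inj₂ (inj₂ (≤n+j , _)))  = ⊥-elim (ℕ.<⇒≱ (ℕ.+-monoʳ-< n j<n) (ℕ.≤-trans (ℕ.m≤m+n (n + n) c) ≤n+j))

      ∈R-z⁻ : ∀ {k} → k < i → Remaining a b c (n + n + k) → c ≤ k
      ∈R-z⁻ {k} k<i (inj₁ (_ , <n))        = ⊥-elim (ℕ.<⇒≱ <n (n≤n+n+ k))
      ∈R-z⁻ {k} k<i (inj₂ (inj₁ (_ , <n+n))) = ⊥-elim (ℕ.<⇒≱ <n+n (ℕ.m≤m+n (n + n) k))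
      ∈R-z⁻ k<i (inj₂ (inj₂ (≤ , _)))        = ℕ.+-cancelˡ-≤ (n + n) _ _ ≤

      ∈R-v⁺ : ∀ {j} → j < n → a ≤ j → Remaining a b c j
      ∈R-v⁺ j<n a≤j = inj₁ (a≤j , j<n)

      ∈R-u⁺ : ∀ {j} → j < n → b ≤ j → Remaining a b c (n + j)
      ∈R-u⁺ j<n b≤j = inj₂ (inj₁ (ℕ.+-monoʳ-≤ n b≤j , ℕ.+-monoʳ-< n j<n))

      ∈R-z⁺ : ∀ {k} → k < i → c ≤ k → Remaining a b c (n + n + k)
      ∈R-z⁺ k<i c≤k = inj₂ (inj₂ (ℕ.+-monoʳ-≤ (n + n) c≤k , ℕ.+-monoʳ-< (n + n) k<i))

      ∈R-≥ : ∀ {x} → a ≤ n → Remaining a b c x → a ≤ x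
      ∈R-≥ a≤n (inj₁ (a≤x , _))          = a≤x
      ∈R-≥ a≤n (inj₂ (inj₁ (n+b≤x , _))) = ℕ.≤-trans a≤n (ℕ.≤-trans (n≤n+ b) n+b≤x)
      ∈R-≥ a≤n (inj₂ (inj₂ (≤x , _)))    = ℕ.≤-trans a≤n (ℕ.≤-trans (n≤n+n+ c) ≤x)

    Remaining-mono : ∀ {a b c a′ b′ c′} → a ≤ a′ → b ≤ b′ → c ≤ c′ → ∀ x → Remaining a′ b′ c′ x → Remaining a b c x
    Remaining-mono a≤ b≤ c≤ x (inj₁ (a′≤x , x<n))        = inj₁ (ℕ.≤-trans a≤ a′≤x , x<n)
    Remaining-mono a≤ b≤ c≤ x (inj₂ (inj₁ (≤x , x<)))    = inj₂ (inj₁ (ℕ.≤-trans (ℕ.+-monoʳ-≤ n b≤) ≤x , x<))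
    Remaining-mono a≤ b≤ c≤ x (inj₂ (inj₂ (≤x , x<)))    = inj₂ (inj₂ (ℕ.≤-trans (ℕ.+-monoʳ-≤ (n + n) c≤) ≤x , x<))

    module _ {a b c : ℕ} where

      remove-v⁻ : ∀ x → (Remaining a b c ∖ a) x → Remaining (suc a) b c x
      remove-v⁻ x (inj₁ (a≤x , x<n) , x≢a) = inj₁ (ℕ.≤∧≢⇒< a≤x (x≢a ∘ sym) , x<n)
      remove-v⁻ x (inj₂ x∈ , _)            = inj₂ x∈

      remove-v⁺ : a < n → ∀ x → Remaining (suc a) b c x → (Remaining a b c ∖ a) x
      remove-v⁺ a<n x x∈ = Remaining-mono (ℕ.n≤1+n a) ℕ.≤-refl ℕ.≤-refl x x∈ , ℕ.>⇒≢ (∈R-≥ a<n x∈)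

      remove-u⁻ : ∀ x → (Remaining a b c ∖ (n + b)) x → Remaining a (suc b) c x
      remove-u⁻ x (inj₁ x∈ , _)                   = inj₁ x∈
      remove-u⁻ x (inj₂ (inj₁ (≤x , x<)) , x≢) =
        inj₂ (inj₁ (subst (_≤ x) (sym (ℕ.+-suc n b)) (ℕ.≤∧≢⇒< ≤x (x≢ ∘ sym)) , x<))
      remove-u⁻ x (inj₂ (inj₂ x∈) , _)            = inj₂ (inj₂ x∈)

      remove-u⁺ : b < n → ∀ x → Remaining a (suc b) c x → (Remaining a b c ∖ (n + b)) x
      remove-u⁺ b<n x x∈ = Remaining-mono ℕ.≤-refl (ℕ.n≤1+n b) ℕ.≤-refl x x∈ , x≢ x∈
        where
        x≢ : Remaining a (suc b) c x → x ≢ n + b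
        x≢ (inj₁ (_ , x<n))        = ℕ.<⇒≢ (ℕ.<-≤-trans x<n (n≤n+ b))
        x≢ (inj₂ (inj₁ (≤x , _)))  = ℕ.>⇒≢ (subst (_≤ x) (ℕ.+-suc n b) ≤x)
        x≢ (inj₂ (inj₂ (≤x , _)))  = ℕ.>⇒≢ (ℕ.<-≤-trans (ℕ.+-monoʳ-< n b<n) (ℕ.≤-trans (ℕ.m≤m+n (n + n) c) ≤x))

      remove-z⁻ : ∀ x → (Remaining a b c ∖ (n + n + c)) x → Remaining a b (suc c) x
      remove-z⁻ x (inj₁ x∈ , _)                = inj₁ x∈
      remove-z⁻ x (inj₂ (inj₁ x∈) , _)         = inj₂ (inj₁ x∈)
      remove-z⁻ x (inj₂ (inj₂ (≤x , x<)) , x≢) =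
        inj₂ (inj₂ (subst (_≤ x) (sym (ℕ.+-suc (n + n) c)) (ℕ.≤∧≢⇒< ≤x (x≢ ∘ sym)) , x<))

      remove-z⁺ : ∀ x → Remaining a b (suc c) x → (Remaining a b c ∖ (n + n + c)) x
      remove-z⁺ x x∈ = Remaining-mono ℕ.≤-refl ℕ.≤-refl (ℕ.n≤1+n c) x x∈ , x≢ x∈
        where
        x≢ : Remaining a b (suc c) x → x ≢ n + n + c
        x≢ (inj₁ (_ , x<n))        = ℕ.<⇒≢ (ℕ.<-≤-trans x<n (n≤n+n+ c))
        x≢ (inj₂ (inj₁ (_ , x<)))  = ℕ.<⇒≢ (ℕ.<-≤-trans x< (ℕ.m≤m+n (n + n) c))
        x≢ (inj₂ (inj₂ (≤x , _)))  = ℕ.>⇒≢ (subst (_≤ x) (ℕ.+-suc (n + n) c) ≤x)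

    no-arc-into-v : ∀ {a b c w x} → x ≡ a → a < n → Remaining a b c w → Arc n i w x → ⊥
    no-arc-into-v refl a<n w∈ (vv j sj<n) = ℕ.<⇒≱ (ℕ.n<1+n j) (∈R-v⁻ (ℕ.<-trans (ℕ.n<1+n j) sj<n) w∈)
    no-arc-into-v refl a<n w∈ (uu j _)    = ℕ.<⇒≱ a<n (n≤n+ (suc j))
    no-arc-into-v refl a<n w∈ (vu j _)    = ℕ.<⇒≱ a<n (n≤n+ j)
    no-arc-into-v refl a<n w∈ (vz _)      = ℕ.<⇒≱ a<n (n≤n+ n)
    no-arc-into-v refl a<n w∈ (zz k _)    = ℕ.<⇒≱ a<n (n≤n+n+ (suc k))

    no-arc-into-u : ∀ {a b c w x} → x ≡ n + b → b < a → a ≤ n → Remaining a b c w → Arc n i w x → ⊥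
    no-arc-into-u {b = b} x≡ b<a a≤n w∈ (vv j sj<n) = ℕ.<⇒≱ sj<n (subst (n ≤_) (sym x≡) (n≤n+ b))
    no-arc-into-u x≡ b<a a≤n w∈ (uu j sj<n) with ℕ.+-cancelˡ-≡ n _ _ x≡
    ... | refl = ℕ.<⇒≱ (ℕ.n<1+n j) (∈R-u⁻ (ℕ.<-trans (ℕ.n<1+n j) sj<n) w∈)
    no-arc-into-u x≡ b<a a≤n w∈ (vu j j<n) with ℕ.+-cancelˡ-≡ n _ _ x≡
    ... | refl = ℕ.<⇒≱ b<a (∈R-v⁻ j<n w∈)
    no-arc-into-u x≡ b<a a≤n w∈ (vz _) with ℕ.+-cancelˡ-≡ n _ _ x≡
    ... | refl = ℕ.<⇒≱ b<a a≤n
    no-arc-into-u x≡ b<a a≤n w∈ (zz k _) with ℕ.+-cancelˡ-≡ n _ _ (trans (sym (ℕ.+-assoc n n (suc k))) x≡)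
    ... | refl = ℕ.<⇒≱ b<a (ℕ.≤-trans a≤n (n≤n+ (suc k)))

    no-arc-into-z : ∀ {a b c w x} → x ≡ n + n + c → (0 < c ⊎ 2 ≤ a) → Remaining a b c w → Arc n i w x → ⊥
    no-arc-into-z {c = c} x≡ _ w∈ (vv j sj<n) = ℕ.<⇒≱ sj<n (subst (n ≤_) (sym x≡) (n≤n+n+ c))
    no-arc-into-z {c = c} x≡ _ w∈ (uu j sj<n) =
      ℕ.<⇒≱ (ℕ.+-monoʳ-< n sj<n) (subst (n + n ≤_) (sym x≡) (ℕ.m≤m+n (n + n) c))
    no-arc-into-z {c = c} x≡ _ w∈ (vu j j<n)  =
      ℕ.<⇒≱ (ℕ.+-monoʳ-< n j<n) (subst (n + n ≤_) (sym x≡) (ℕ.m≤m+n (n + n) c))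
    no-arc-into-z x≡ c>0⊎a≥2 w∈ (vz _) with ℕ.+-cancelˡ-≡ (n + n) 0 _ (trans (ℕ.+-identityʳ (n + n)) x≡)
    no-arc-into-z x≡ (inj₁ ()) w∈ (vz _) | refl
    no-arc-into-z x≡ (inj₂ a≥2) w∈ (vz _) | refl = ℕ.<⇒≱ (s≤s (∈R-v⁻ 2≤n w∈)) a≥2
    no-arc-into-z x≡ _ w∈ (zz k sk<i) with ℕ.+-cancelˡ-≡ (n + n) _ _ x≡
    ... | refl = ℕ.<⇒≱ (ℕ.n<1+n k) (∈R-z⁻ (ℕ.<-trans (ℕ.n<1+n k) sk<i) w∈)

    module _ {a b c : ℕ} (y : Fin (n + n + i)) where

      source : Remaining a b c (toℕ y) → (∀ {w} → Remaining a b c w → Arc n i w (toℕ y) → ⊥) →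
               IsSource G (Remaining a b c) y
      source y∈ no-arc = y∈ , λ w w∈ arc → no-arc w∈ (arc⁻ n i arc)

      ¬source-∉ : ¬ Remaining a b c (toℕ y) → ¬ IsSource G (Remaining a b c) y
      ¬source-∉ y∉ (y∈ , _) = y∉ y∈

      ¬source-arc : ∀ {w} → w < n + n + i → Remaining a b c w → Arc n i w (toℕ y) → ¬ IsSource G (Remaining a b c) y
      ¬source-arc {w} w<N w∈ arc (_ , no-arc) =
        no-arc (fromℕ< w<N) (subst (Remaining a b c) (sym (toℕ-fromℕ< w<N)) w∈)
               (arc⁺ n i (subst (λ x → Arc n i x (toℕ y)) (sym (toℕ-fromℕ< w<N)) arc))

    private
      <N-v : ∀ {j} → j < n → j < n + n + i
      <N-v j<n = ℕ.<-≤-trans j<n (n≤n+n+ i)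
      <N-u : ∀ {j} → j < n → n + j < n + n + i
      <N-u j<n = ℕ.<-≤-trans (ℕ.+-monoʳ-< n j<n) (ℕ.m≤m+n (n + n) i)
      <N-z : ∀ {k} → k < i → n + n + k < n + n + i
      <N-z = ℕ.+-monoʳ-< (n + n)
      predecessor : ∀ {a j} → a ≤ j → j ≢ a → ∃ λ j′ → j ≡ suc j′ × a ≤ j′
      predecessor {j = suc j′} a≤j j≢a = j′ , refl , ℕ.≤-pred (ℕ.≤∧≢⇒< a≤j (j≢a ∘ sym))
      predecessor {j = zero}   z≤n j≢a = ⊥-elim (j≢a refl)

    module _ {a b c : ℕ} (y : Fin (n + n + i)) where

      ¬source-v : ∀ {j} → toℕ y ≡ j → j < n → j ≢ a → ¬ IsSource G (Remaining a b c) y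
      ¬source-v {j} y≡j j<n j≢a with a ≤? j
      ... | no a≰j  = ¬source-∉ y (a≰j ∘ ∈R-v⁻ j<n ∘ subst (Remaining a b c) y≡j)
      ... | yes a≤j with predecessor a≤j j≢a
      ...   | j′ , refl , a≤j′ = ¬source-arc y (<N-v j′<n) (∈R-v⁺ j′<n a≤j′) (subst (Arc n i j′) (sym y≡j) (vv j′ j<n))
        where j′<n = ℕ.<-trans (ℕ.n<1+n j′) j<n

      ¬source-u : ∀ {j} → toℕ y ≡ n + j → j < n → j ≢ b → ¬ IsSource G (Remaining a b c) y
      ¬source-u {j} y≡ j<n j≢b with b ≤? j
      ... | no b≰j  = ¬source-∉ y (b≰j ∘ ∈R-u⁻ j<n ∘ subst (Remaining a b c) y≡)
      ... | yes b≤j with predecessor b≤j j≢b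
      ...   | j′ , refl , b≤j′ =
        ¬source-arc y (<N-u j′<n) (∈R-u⁺ j′<n b≤j′) (subst (Arc n i (n + j′)) (sym y≡) (uu j′ j<n))
        where j′<n = ℕ.<-trans (ℕ.n<1+n j′) j<n

      ¬source-u-blocked : toℕ y ≡ n + b → b < n → a ≤ b → ¬ IsSource G (Remaining a b c) y
      ¬source-u-blocked y≡ b<n a≤b = ¬source-arc y (<N-v b<n) (∈R-v⁺ b<n a≤b) (subst (Arc n i b) (sym y≡) (vu b b<n))

      ¬source-z : ∀ {k} → toℕ y ≡ n + n + k → k < i → k ≢ c → ¬ IsSource G (Remaining a b c) y
      ¬source-z {k} y≡ k<i k≢c with c ≤? k
      ... | no c≰k  = ¬source-∉ y (c≰k ∘ ∈R-z⁻ k<i ∘ subst (Remaining a b c) y≡)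
      ... | yes c≤k with predecessor c≤k k≢c
      ...   | k′ , refl , c≤k′ =
        ¬source-arc y (<N-z k′<i) (∈R-z⁺ k′<i c≤k′) (subst (Arc n i (n + n + k′)) (sym y≡) (zz k′ k<i))
        where k′<i = ℕ.<-trans (ℕ.n<1+n k′) k<i

      ¬source-z-blocked : toℕ y ≡ n + n + 0 → 0 < i → a ≤ 1 → ¬ IsSource G (Remaining a b c) y
      ¬source-z-blocked y≡ 0<i a≤1 =
        ¬source-arc y (<N-v 2≤n) (∈R-v⁺ 2≤n a≤1)
          (subst (Arc n i 1) (sym (trans y≡ (ℕ.+-identityʳ (n + n)))) (vz 0<i))

    -- z_{c+1} is a source once v₂ has been listed (or, for c > 0, once z_c has).
    TailSource : ℕ → ℕ → Set
    TailSource a c = c < i × (0 < c ⊎ 2 ≤ a)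

    tailSource? : ∀ a c → Dec (TailSource a c)
    tailSource? a c = (c <? i) ×-dec ((0 <? c) ⊎-dec (2 ≤? a))

    module Step (a b c m : ℕ) where

      V₁ V₂ V₃ : ℕ
      V₁ = when (a <? n) (#R (suc a) b c m)
      V₂ = when (b <? a) (#R a (suc b) c m)
      V₃ = when (tailSource? a c) (#R a b (suc c) m)

      contribution : ℕ → ℕ
      contribution x = point a V₁ x + (point (n + b) V₂ x + point (n + n + c) V₃ x)

      private
        S? = remaining? a b c

      module _ (a≤n : a ≤ n) where

        firsts-v : ∀ (y : Fin (n + n + i)) {j} → toℕ y ≡ j → j < n → firsts G S? m y ≡ point a V₁ j
        firsts-v y {j} y≡j j<n with j ≟ a
        ... | yes refl = begin
          firsts G S? m y
            ≡⟨ firsts-source G S? (remaining? (suc a) b c) m y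
                 (source y (subst (Remaining a b c) (sym y≡j) (∈R-v⁺ j<n ℕ.≤-refl)) (no-arc-into-v y≡j j<n))
                 (λ x → remove-v⁻ x ∘ ∖-≡ {Remaining a b c} y≡j) (λ x → ∖-≡ {Remaining a b c} (sym y≡j) ∘ remove-v⁺ j<n x) ⟩
          #R (suc a) b c m  ≡⟨ sym (when-yes (a <? n) j<n) ⟩
          V₁                ≡⟨ sym (point-here a V₁) ⟩
          point a V₁ a         ∎
          where open ≡-Reasoning
        ... | no j≢a = trans (firsts-nonSource G S? m y (¬source-v y y≡j j<n j≢a)) (sym (point-elsewhere a V₁ j≢a))

        firsts-u : ∀ (y : Fin (n + n + i)) {j} → toℕ y ≡ n + j → j < n → firsts G S? m y ≡ point (n + b) V₂ (n + j)
        firsts-u y {j} y≡ j<n with j ≟ b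
        ... | no j≢b = trans (firsts-nonSource G S? m y (¬source-u y y≡ j<n j≢b))
                             (sym (point-elsewhere (n + b) V₂ (j≢b ∘ ℕ.+-cancelˡ-≡ n _ _)))
        ... | yes refl with j <? a
        ...   | yes j<a = begin
          firsts G S? m y
            ≡⟨ firsts-source G S? (remaining? a (suc j) c) m y
                 (source y (subst (Remaining a j c) (sym y≡) (∈R-u⁺ j<n ℕ.≤-refl)) (no-arc-into-u y≡ j<a a≤n))
                 (λ x → remove-u⁻ x ∘ ∖-≡ {Remaining a j c} y≡) (λ x → ∖-≡ {Remaining a j c} (sym y≡) ∘ remove-u⁺ j<n x) ⟩
          #R a (suc j) c m  ≡⟨ sym (when-yes (j <? a) j<a) ⟩
          V₂                ≡⟨ sym (point-here (n + j) V₂) ⟩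
          point (n + j) V₂ (n + j) ∎
          where open ≡-Reasoning
        ...   | no j≮a = begin
          firsts G S? m y          ≡⟨ firsts-nonSource G S? m y (¬source-u-blocked y y≡ j<n (ℕ.≮⇒≥ j≮a)) ⟩
          0                        ≡⟨ sym (when-0 (n + j ≟ n + j)) ⟩
          point (n + j) 0 (n + j)     ≡⟨ cong (λ v → point (n + j) v (n + j)) (sym (when-no (j <? a) j≮a)) ⟩
          point (n + j) V₂ (n + j)    ∎
          where open ≡-Reasoning

        firsts-z : ∀ (y : Fin (n + n + i)) {k} → toℕ y ≡ n + n + k → k < i → firsts G S? m y ≡ point (n + n + c) V₃ (n + n + k)
        firsts-z y {k} y≡ k<i with k ≟ c
        ... | no k≢c = trans (firsts-nonSource G S? m y (¬source-z y y≡ k<i k≢c))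
                             (sym (point-elsewhere (n + n + c) V₃ (k≢c ∘ ℕ.+-cancelˡ-≡ (n + n) _ _)))
        ... | yes refl with (0 <? k) ⊎-dec (2 ≤? a)
        ...   | yes detached = begin
          firsts G S? m y
            ≡⟨ firsts-source G S? (remaining? a b (suc k)) m y
                 (source y (subst (Remaining a b k) (sym y≡) (∈R-z⁺ k<i ℕ.≤-refl)) (no-arc-into-z y≡ detached))
                 (λ x → remove-z⁻ x ∘ ∖-≡ {Remaining a b k} y≡) (λ x → ∖-≡ {Remaining a b k} (sym y≡) ∘ remove-z⁺ x) ⟩
          #R a b (suc k) m          ≡⟨ sym (when-yes (tailSource? a k) (k<i , detached)) ⟩
          V₃                        ≡⟨ sym (point-here (n + n + k) V₃) ⟩
          point (n + n + k) V₃ (n + n + k) ∎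
          where open ≡-Reasoning
        ...   | no attached = begin
          firsts G S? m y
            ≡⟨ firsts-nonSource G S? m y (¬source-z-blocked y (trans y≡ (cong (n + n +_) k≡0)) (subst (_< i) k≡0 k<i) a≤1) ⟩
          0                              ≡⟨ sym (when-0 (n + n + k ≟ n + n + k)) ⟩
          point (n + n + k) 0 (n + n + k)   ≡⟨ cong (λ v → point (n + n + k) v (n + n + k)) (sym (when-no (tailSource? a k) (attached ∘ proj₂))) ⟩
          point (n + n + k) V₃ (n + n + k)  ∎
          where
          open ≡-Reasoning
          k≡0 : k ≡ 0
          k≡0 = ℕ.n≤0⇒n≡0 (ℕ.≮⇒≥ (attached ∘ inj₁))
          a≤1 : a ≤ 1
          a≤1 = ℕ.≤-pred (ℕ.≰⇒> (attached ∘ inj₂))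

        firsts≡contribution : ∀ y → firsts G S? m y ≡ contribution (toℕ y)
        firsts≡contribution y = go (toℕ y) refl (region (toℕ y) (toℕ<n y))
          where
          go : ∀ x → toℕ y ≡ x → Region x → firsts G S? m y ≡ contribution x
          go _ y≡ (v j j<n) = trans (firsts-v y y≡ j<n)
            (sym (trans (cong (point a V₁ j +_) (cong₂ _+_
                           (point-elsewhere (n + b) V₂ (ℕ.<⇒≢ (ℕ.<-≤-trans j<n (n≤n+ b))))
                           (point-elsewhere (n + n + c) V₃ (ℕ.<⇒≢ (ℕ.<-≤-trans j<n (n≤n+n+ c))))))
                        (ℕ.+-identityʳ _)))
          go _ y≡ (u j j<n) = trans (firsts-u y y≡ j<n)
            (sym (cong₂ _+_
                    (point-when-elsewhere (a <? n) a _ (λ a<n → ℕ.>⇒≢ (ℕ.<-≤-trans a<n (n≤n+ j))))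
                    (trans (cong (point (n + b) V₂ (n + j) +_)
                             (point-elsewhere (n + n + c) V₃ (ℕ.<⇒≢ (ℕ.<-≤-trans (ℕ.+-monoʳ-< n j<n) (ℕ.m≤m+n (n + n) c)))))
                           (ℕ.+-identityʳ _))))
          go _ y≡ (z k k<i) = trans (firsts-z y y≡ k<i)
            (sym (cong₂ _+_
                    (point-when-elsewhere (a <? n) a _ (λ a<n → ℕ.>⇒≢ (ℕ.<-≤-trans a<n (n≤n+n+ k))))
                    (cong (_+ point (n + n + c) V₃ (n + n + k))
                      (point-when-elsewhere (b <? a) (n + b) _
                        (λ b<a → ℕ.>⇒≢ (ℕ.<-≤-trans (ℕ.+-monoʳ-< n (ℕ.<-≤-trans b<a a≤n)) (ℕ.m≤m+n (n + n) k)))))))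

        #R-suc : #R a b c (suc m) ≡ V₁ + (V₂ + V₃)
        #R-suc = begin
          #R a b c (suc m)
            ≡⟨ #topSorts-suc G S? m ⟩
          total (firsts G S? m)
            ≡⟨ cong sum (tabulate-cong firsts≡contribution) ⟩
          total (λ y → point a V₁ (toℕ y) + (point (n + b) V₂ (toℕ y) + point (n + n + c) V₃ (toℕ y)))
            ≡⟨ sum-tabulate-+ {n + n + i} (λ y → point a V₁ (toℕ y)) (λ y → point (n + b) V₂ (toℕ y) + point (n + n + c) V₃ (toℕ y)) ⟩
          total (λ y → point a V₁ (toℕ y)) + total (λ y → point (n + b) V₂ (toℕ y) + point (n + n + c) V₃ (toℕ y))
            ≡⟨ cong (total (λ y → point a V₁ (toℕ y)) +_) (sum-tabulate-+ {n + n + i} (λ y → point (n + b) V₂ (toℕ y)) (λ y → point (n + n + c) V₃ (toℕ y))) ⟩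
          total (λ y → point a V₁ (toℕ y)) + (total (λ y → point (n + b) V₂ (toℕ y)) + total (λ y → point (n + n + c) V₃ (toℕ y)))
            ≡⟨ cong₂ _+_ (sum-tabulate-point-when (a <? n) a _ <N-v)
                 (cong₂ _+_ (sum-tabulate-point-when (b <? a) (n + b) _ (λ b<a → <N-u (ℕ.<-≤-trans b<a a≤n)))
                            (sum-tabulate-point-when (tailSource? a c) (n + n + c) _ (<N-z ∘ proj₁))) ⟩
          V₁ + (V₂ + V₃) ∎
          where
          open ≡-Reasoning
          total : (Fin (n + n + i) → ℕ) → ℕ
          total f = sum (tabulate f)

module LadderCount where

  open import Defs
  open import Data.Nat as ℕ using (ℕ; zero; suc; _+_; _*_; _<_; _≤_; s≤s; z≤n; _<?_)
  import Data.Nat.Properties as ℕ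
  open import Data.Nat.Combinatorics using (_C_; nCn≡1)
  open import Data.Nat.Tactic.RingSolver using (solve-∀)
  open import Data.Fin using (toℕ)
  open import Data.Fin.Properties using (toℕ<n)
  open import Data.Product using (_×_; _,_; proj₁)
  open import Data.Sum using (inj₁; inj₂)
  open import Data.Empty using (⊥-elim)
  open import Data.Unit using (tt)
  open import Relation.Binary.PropositionalEquality
  open import Relation.Nullary using (yes; no; ¬_)
  open import Function using (_∘_)
  open Binomial
  open BallotNumbers
  open TopologicalSorts
  open LadderDigraph
  open LadderSorts

  -- The values of Step.V₁, Step.V₂ and Step.V₃ when r v's, r + d u's and t z's remain.
  T₁ T₂ T₃ : ℕ → ℕ → ℕ → ℕ → ℕ
  T₁ m zero    d t = 0
  T₁ m (suc r) d t = (m C t) * ballot r (suc d)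
  T₂ m r zero    t = 0
  T₂ m r (suc d) t = (m C t) * ballot r d
  T₃ m r d zero    = 0
  T₃ m r d (suc t) = (m C t) * ballot r d

  T₁+T₂ : ∀ m r d t → 0 < r + d → T₁ m r d t + T₂ m r d t ≡ (m C t) * ballot r d
  T₁+T₂ m zero    (suc d) t _ = ℕ.+-identityˡ _
  T₁+T₂ m (suc r) zero    t _ = ℕ.+-identityʳ _
  T₁+T₂ m (suc r) (suc d) t _ = sym (ℕ.*-distribˡ-+ (m C t) (ballot r (2 + d)) (ballot (suc r) d))

  private
    T₁+T₂+T₃-positive : ∀ m r d t → 0 < r + d → T₁ m r d t + (T₂ m r d t + T₃ m r d t) ≡ (suc m C t) * ballot r d
    T₁+T₂+T₃-positive m r d zero    r+d>0 = trans (cong (T₁ m r d 0 +_) (ℕ.+-identityʳ _)) (T₁+T₂ m r d 0 r+d>0)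
    T₁+T₂+T₃-positive m r d (suc t) r+d>0 = begin
      T₁ m r d (suc t) + (T₂ m r d (suc t) + (m C t) * ballot r d)
        ≡⟨ sym (ℕ.+-assoc (T₁ m r d (suc t)) _ _) ⟩
      T₁ m r d (suc t) + T₂ m r d (suc t) + (m C t) * ballot r d
        ≡⟨ cong (_+ (m C t) * ballot r d) (T₁+T₂ m r d (suc t) r+d>0) ⟩
      (m C suc t) * ballot r d + (m C t) * ballot r d
        ≡⟨ sym (ℕ.*-distribʳ-+ (ballot r d) (m C suc t) (m C t)) ⟩
      (m C suc t + m C t) * ballot r d
        ≡⟨ cong (_* ballot r d) (trans (ℕ.+-comm (m C suc t) (m C t)) (sym ([n+1]C[k+1]≡nCk+nC[k+1] m t))) ⟩
      (suc m C suc t) * ballot r d ∎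
      where open ≡-Reasoning

  T₁+T₂+T₃ : ∀ m r d t → r + (r + d) + t ≡ suc m → T₁ m r d t + (T₂ m r d t + T₃ m r d t) ≡ (suc m C t) * ballot r d
  T₁+T₂+T₃ m zero    zero    zero    ()
  T₁+T₂+T₃ m zero    zero    (suc t) size with ℕ.suc-injective size
  ... | refl = cong (_* 1) (trans (nCn≡1 t) (sym (nCn≡1 (suc t))))
  T₁+T₂+T₃ m zero    (suc d) t       size = T₁+T₂+T₃-positive m zero (suc d) t (s≤s z≤n)
  T₁+T₂+T₃ m (suc r) d       t       size = T₁+T₂+T₃-positive m (suc r) d t (s≤s z≤n)

  module ClosedForm (n i : ℕ) (2≤n : 2 ≤ n) where

    open LadderStates n i 2≤n

    record Shape (m r d t a b c : ℕ) : Set where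
      field
        size     : r + (r + d) + t ≡ m
        v-left   : a + r ≡ n
        u-left   : b + (r + d) ≡ n
        z-left   : c + t ≡ i
        detached : 2 ≤ a

    open Shape

    a≤n : ∀ {m r d t a b c} → Shape m r d t a b c → a ≤ n
    a≤n {r = r} {a = a} s = subst (a ≤_) (v-left s) (ℕ.m≤m+n a r)

    b+d≡a : ∀ {m r d t a b c} → Shape m r d t a b c → b + d ≡ a
    b+d≡a {r = r} {d} {a = a} {b} s =
      ℕ.+-cancelʳ-≡ r (b + d) a (trans (swap b d r) (trans (u-left s) (sym (v-left s))))
      where
      swap : ∀ b d r → b + d + r ≡ b + (r + d)
      swap = solve-∀

    vanish : ∀ r d t → r + (r + d) + t ≡ 0 → r ≡ 0 × d ≡ 0 × t ≡ 0
    vanish r d t size = ℕ.m+n≡0⇒m≡0 r r+d≡0 , ℕ.m+n≡0⇒n≡0 r r+d≡0 , ℕ.m+n≡0⇒n≡0 (r + (r + d)) size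
      where r+d≡0 = ℕ.m+n≡0⇒n≡0 r (ℕ.m+n≡0⇒m≡0 (r + (r + d)) size)

    #R-closed : ∀ m r d t a b c → Shape m r d t a b c → #R a b c m ≡ (m C t) * ballot r d
    V₁-closed : ∀ m r d t a b c → Shape (suc m) r d t a b c → Step.V₁ a b c m ≡ T₁ m r d t
    V₂-closed : ∀ m r d t a b c → Shape (suc m) r d t a b c → Step.V₂ a b c m ≡ T₂ m r d t
    V₃-closed : ∀ m r d t a b c → Shape (suc m) r d t a b c → Step.V₃ a b c m ≡ T₃ m r d t

    #R-closed zero r d t a b c s with vanish r d t (size s)
    ... | refl , refl , refl = count-singleton (isTopSort? G (remaining? a b c) 0) empty-sort
      where
      empty : ∀ x → ¬ Remaining a b c x
      empty x (inj₁ (a≤x , x<n))        = ℕ.<⇒≱ x<n (subst (_≤ x) (trans (sym (ℕ.+-identityʳ a)) (v-left s)) a≤x)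
      empty x (inj₂ (inj₁ (≤x , x<)))    = ℕ.<⇒≱ x< (subst (λ b → n + b ≤ x) (trans (sym (ℕ.+-identityʳ b)) (u-left s)) ≤x)
      empty x (inj₂ (inj₂ (≤x , x<)))    = ℕ.<⇒≱ x< (subst (λ c → n + n + c ≤ x) (trans (sym (ℕ.+-identityʳ c)) (z-left s)) ≤x)
      empty-sort : IsTopSort G (Remaining a b c) 0 (λ ())
      empty-sort = (λ ()) , (λ ()) , (λ w w∈ → ⊥-elim (empty (toℕ w) w∈)) , (λ ())
    #R-closed (suc m) r d t a b c s = begin
      #R a b c (suc m)               ≡⟨ Step.#R-suc a b c m (a≤n s) ⟩
      Step.V₁ a b c m + (Step.V₂ a b c m + Step.V₃ a b c m)
        ≡⟨ cong₂ _+_ (V₁-closed m r d t a b c s) (cong₂ _+_ (V₂-closed m r d t a b c s) (V₃-closed m r d t a b c s)) ⟩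
      T₁ m r d t + (T₂ m r d t + T₃ m r d t) ≡⟨ T₁+T₂+T₃ m r d t (size s) ⟩
      (suc m C t) * ballot r d       ∎
      where open ≡-Reasoning

    V₁-closed m zero d t a b c s = when-no (a <? n) (ℕ.<-irrefl (trans (sym (ℕ.+-identityʳ a)) (v-left s)))
    V₁-closed m (suc r) d t a b c s = trans (when-yes (a <? n) (subst (a <_) (v-left s) (ℕ.m<m+n a (s≤s z≤n))))
      (#R-closed m r (suc d) t (suc a) b c record
        { size = ℕ.suc-injective (trans (resize r d t) (size s)) ; v-left = trans (sym (ℕ.+-suc a r)) (v-left s)
        ; u-left = trans (cong (b +_) (ℕ.+-suc r d)) (u-left s) ; z-left = z-left s ; detached = ℕ.m≤n⇒m≤1+n (detached s) })
      where
      resize : ∀ r d t → suc (r + (r + suc d) + t) ≡ suc r + (suc r + d) + t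
      resize = solve-∀

    V₂-closed m r zero t a b c s = when-no (b <? a) (ℕ.<-irrefl (trans (sym (ℕ.+-identityʳ b)) (b+d≡a s)))
    V₂-closed m r (suc d) t a b c s = trans (when-yes (b <? a) (subst (b <_) (b+d≡a s) (ℕ.m<m+n b (s≤s z≤n))))
      (#R-closed m r d t a (suc b) c record
        { size = ℕ.suc-injective (trans (resize r d t) (size s)) ; v-left = v-left s
        ; u-left = trans (sym (ℕ.+-suc b (r + d))) (trans (cong (b +_) (sym (ℕ.+-suc r d))) (u-left s))
        ; z-left = z-left s ; detached = detached s })
      where
      resize : ∀ r d t → suc (r + (r + d) + t) ≡ r + (r + suc d) + t
      resize = solve-∀

    V₃-closed m r d zero a b c s = when-no (tailSource? a c) (ℕ.<-irrefl (trans (sym (ℕ.+-identityʳ c)) (z-left s)) ∘ proj₁)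
    V₃-closed m r d (suc t) a b c s =
      trans (when-yes (tailSource? a c) (subst (c <_) (z-left s) (ℕ.m<m+n c (s≤s z≤n)) , inj₂ (detached s)))
        (#R-closed m r d t a b (suc c) record
          { size = ℕ.suc-injective (trans (resize r d t) (size s)) ; v-left = v-left s ; u-left = u-left s
          ; z-left = trans (sym (ℕ.+-suc c t)) (z-left s) ; detached = detached s })
      where
      resize : ∀ r d t → suc (r + (r + d) + t) ≡ r + (r + d) + suc t
      resize = solve-∀

  σ-ladder : ∀ p i → σ (ladder (2 + p) i)
             ≡ ((p + (p + 2) + i) C i) * ballot p 2 + ((p + (p + 1) + i) C i) * ballot p 1
  σ-ladder p i = begin
    σ (ladder n i)
      ≡⟨ σ≡#topSorts (ladder n i) ⟩
    #topSorts (ladder n i) (λ _ → yes tt) (n + n + i)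
      ≡⟨ #topSorts-≐ (ladder n i) (λ _ → yes tt) (remaining? 0 0 0) (λ w _ → everything (toℕ<n w)) (λ _ _ → tt) (n + n + i) ⟩
    #R 0 0 0 (n + n + i)
      ≡⟨ cong (#R 0 0 0) (size p i) ⟩
    #R 0 0 0 (2 + m₂)
      ≡⟨ Step.#R-suc 0 0 0 (suc m₂) z≤n ⟩
    #R 1 0 0 (suc m₂) + (0 + Step.V₃ 0 0 0 (suc m₂))
      ≡⟨ cong (λ x → #R 1 0 0 (suc m₂) + x) (when-no (tailSource? 0 0) (λ { (_ , inj₁ ()) ; (_ , inj₂ ()) })) ⟩
    #R 1 0 0 (suc m₂) + 0
      ≡⟨ ℕ.+-identityʳ _ ⟩
    #R 1 0 0 (suc m₂)
      ≡⟨ Step.#R-suc 1 0 0 m₂ (s≤s z≤n) ⟩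
    #R 2 0 0 m₂ + (#R 1 1 0 m₂ + Step.V₃ 1 0 0 m₂)
      ≡⟨ cong (λ x → #R 2 0 0 m₂ + (#R 1 1 0 m₂ + x)) (when-no (tailSource? 1 0) (λ { (_ , inj₁ ()) ; (_ , inj₂ (s≤s ())) })) ⟩
    #R 2 0 0 m₂ + (#R 1 1 0 m₂ + 0)
      ≡⟨ cong (λ x → #R 2 0 0 m₂ + (#R 1 1 0 x + 0)) (m₂≡ p i) ⟩
    #R 2 0 0 m₂ + (#R 1 1 0 (suc m₃) + 0)
      ≡⟨ cong (λ x → #R 2 0 0 m₂ + (x + 0)) (Step.#R-suc 1 1 0 m₃ (s≤s z≤n)) ⟩
    #R 2 0 0 m₂ + ((#R 2 1 0 m₃ + (0 + Step.V₃ 1 1 0 m₃)) + 0)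
      ≡⟨ cong (λ x → #R 2 0 0 m₂ + ((#R 2 1 0 m₃ + x) + 0)) (when-no (tailSource? 1 0) (λ { (_ , inj₁ ()) ; (_ , inj₂ (s≤s ())) })) ⟩
    #R 2 0 0 m₂ + ((#R 2 1 0 m₃ + 0) + 0)
      ≡⟨ cong (#R 2 0 0 m₂ +_) (trans (ℕ.+-identityʳ _) (ℕ.+-identityʳ _)) ⟩
    #R 2 0 0 m₂ + #R 2 1 0 m₃
      ≡⟨ cong₂ _+_ (#R-closed m₂ p 2 i 2 0 0 record { size = refl ; v-left = refl ; u-left = ℕ.+-comm p 2 ; z-left = refl ; detached = ℕ.≤-refl })
                   (#R-closed m₃ p 1 i 2 1 0 record { size = refl ; v-left = refl ; u-left = cong suc (ℕ.+-comm p 1) ; z-left = refl ; detached = ℕ.≤-refl }) ⟩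
    (m₂ C i) * ballot p 2 + (m₃ C i) * ballot p 1 ∎
    where
    open ≡-Reasoning
    n = 2 + p
    open LadderStates n i (s≤s (s≤s z≤n))
    open ClosedForm n i (s≤s (s≤s z≤n))
    m₂ = p + (p + 2) + i
    m₃ = p + (p + 1) + i
    size : ∀ p i → (2 + p) + (2 + p) + i ≡ 2 + (p + (p + 2) + i)
    size = solve-∀
    m₂≡ : ∀ p i → p + (p + 2) + i ≡ suc (p + (p + 1) + i)
    m₂≡ = solve-∀
    everything : ∀ {x} → x < n + n + i → Remaining 0 0 0 x
    everything {x} x<N with x <? n | x <? n + n
    ... | yes x<n | _         = inj₁ (z≤n , x<n)
    ... | no x≮n  | yes x<n+n = inj₂ (inj₁ (subst (_≤ x) (sym (ℕ.+-identityʳ n)) (ℕ.≮⇒≥ x≮n) , x<n+n))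
    ... | no _    | no x≮n+n  = inj₂ (inj₂ (subst (_≤ x) (sym (ℕ.+-identityʳ (n + n))) (ℕ.≮⇒≥ x≮n+n) , x<N))

module FiniteDifferences where

  open import Data.Nat as ℕ using (ℕ; zero; suc; _∸_; _<_; s≤s; z≤n)
  import Data.Nat.Properties as ℕ
  open import Data.Nat.Combinatorics using (_C_; k>n⇒nCk≡0)
  open import Data.Integer using (ℤ; +_; 0ℤ; _+_; _*_; _-_; -_; _^_)
  import Data.Integer.Properties as ℤ
  open import Data.Integer.Tactic.RingSolver using (solve-∀)
  open import Function using (_∘_)
  open import Relation.Binary.PropositionalEquality
  open Binomial using ([n+1]C[k+1]≡nCk+nC[k+1])

  ∑ : ℕ → (ℕ → ℤ) → ℤ
  ∑ zero    f = 0ℤ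
  ∑ (suc n) f = f 0 + ∑ n (f ∘ suc)

  infix 5 ∑
  syntax ∑ n (λ i → e) = ∑[ i < n ] e

  ∑-snoc : ∀ n f → ∑ (suc n) f ≡ ∑ n f + f n
  ∑-snoc zero    f = trans (ℤ.+-identityʳ (f 0)) (sym (ℤ.+-identityˡ (f 0)))
  ∑-snoc (suc n) f = trans (cong (λ x → f 0 + x) (∑-snoc n (f ∘ suc))) (sym (ℤ.+-assoc (f 0) _ _))

  ∑-cong : ∀ n {f g} → (∀ i → i < n → f i ≡ g i) → ∑ n f ≡ ∑ n g
  ∑-cong zero    eq = refl
  ∑-cong (suc n) eq = cong₂ _+_ (eq 0 (s≤s z≤n)) (∑-cong n (λ i i<n → eq (suc i) (s≤s i<n)))

  ∑-+ : ∀ n f g → ∑[ i < n ] (f i + g i) ≡ ∑ n f + ∑ n g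
  ∑-+ zero    f g = refl
  ∑-+ (suc n) f g = trans (cong (λ x → f 0 + g 0 + x) (∑-+ n (f ∘ suc) (g ∘ suc))) (interchange (f 0) (g 0) _ _)
    where
    interchange : ∀ a b c d → a + b + (c + d) ≡ a + c + (b + d)
    interchange = solve-∀

  ∑-neg : ∀ n f → ∑[ i < n ] (- f i) ≡ - ∑ n f
  ∑-neg zero    f = refl
  ∑-neg (suc n) f = trans (cong (λ x → - f 0 + x) (∑-neg n (f ∘ suc))) (sym (ℤ.neg-distrib-+ (f 0) _))

  sign : ℕ → ℤ
  sign j = (- + 1) ^ j

  Δ^ : ℕ → (ℕ → ℤ) → ℤ
  Δ^ zero    f = f 0
  Δ^ (suc k) f = Δ^ k (f ∘ suc) - Δ^ k f

  Δ^-cong : ∀ k {f g} → (∀ i → f i ≡ g i) → Δ^ k f ≡ Δ^ k g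
  Δ^-cong zero    eq = eq 0
  Δ^-cong (suc k) eq = cong₂ _-_ (Δ^-cong k (eq ∘ suc)) (Δ^-cong k eq)

  Δ^-linear : ∀ k f g α β → Δ^ k (λ i → f i * α + g i * β) ≡ Δ^ k f * α + Δ^ k g * β
  Δ^-linear zero    f g α β = refl
  Δ^-linear (suc k) f g α β =
    trans (cong₂ _-_ (Δ^-linear k (f ∘ suc) (g ∘ suc) α β) (Δ^-linear k f g α β))
          (collect (Δ^ k (f ∘ suc)) (Δ^ k f) (Δ^ k (g ∘ suc)) (Δ^ k g) α β)
    where
    collect : ∀ a b c d α β → a * α + c * β - (b * α + d * β) ≡ (a - b) * α + (c - d) * β
    collect = solve-∀

  Δ^-binomial : ∀ k M s → Δ^ k (λ i → + ((M ℕ.+ (s ℕ.+ i)) C (s ℕ.+ i))) ≡ + ((M ℕ.+ s) C (s ℕ.+ k))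
  Δ^-binomial zero    M s = cong (λ j → + ((M ℕ.+ j) C (s ℕ.+ 0))) (ℕ.+-identityʳ s)
  Δ^-binomial (suc k) M s = begin
    Δ^ k (λ i → + ((M ℕ.+ (s ℕ.+ suc i)) C (s ℕ.+ suc i))) - Δ^ k (λ i → + ((M ℕ.+ (s ℕ.+ i)) C (s ℕ.+ i)))
      ≡⟨ cong (_- Δ^ k (λ i → + ((M ℕ.+ (s ℕ.+ i)) C (s ℕ.+ i)))) (Δ^-cong k (λ i → cong (λ j → + ((M ℕ.+ j) C j)) (ℕ.+-suc s i))) ⟩
    Δ^ k (λ i → + ((M ℕ.+ (suc s ℕ.+ i)) C (suc s ℕ.+ i))) - Δ^ k (λ i → + ((M ℕ.+ (s ℕ.+ i)) C (s ℕ.+ i)))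
      ≡⟨ cong₂ _-_ (Δ^-binomial k M (suc s)) (Δ^-binomial k M s) ⟩
    + ((M ℕ.+ suc s) C suc (s ℕ.+ k)) - + ((M ℕ.+ s) C (s ℕ.+ k))
      ≡⟨ cong (λ j → + (j C suc (s ℕ.+ k)) - + ((M ℕ.+ s) C (s ℕ.+ k))) (ℕ.+-suc M s) ⟩
    + (suc (M ℕ.+ s) C suc (s ℕ.+ k)) - + ((M ℕ.+ s) C (s ℕ.+ k))
      ≡⟨ cong (λ c → + c - + ((M ℕ.+ s) C (s ℕ.+ k))) ([n+1]C[k+1]≡nCk+nC[k+1] (M ℕ.+ s) (s ℕ.+ k)) ⟩
    + ((M ℕ.+ s) C (s ℕ.+ k) ℕ.+ (M ℕ.+ s) C suc (s ℕ.+ k)) - + ((M ℕ.+ s) C (s ℕ.+ k))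
      ≡⟨ cong (_- + ((M ℕ.+ s) C (s ℕ.+ k))) (ℤ.pos-+ ((M ℕ.+ s) C (s ℕ.+ k)) _) ⟩
    + ((M ℕ.+ s) C (s ℕ.+ k)) + + ((M ℕ.+ s) C suc (s ℕ.+ k)) - + ((M ℕ.+ s) C (s ℕ.+ k))
      ≡⟨ cancel (+ ((M ℕ.+ s) C (s ℕ.+ k))) _ ⟩
    + ((M ℕ.+ s) C suc (s ℕ.+ k))
      ≡⟨ cong (λ j → + ((M ℕ.+ s) C j)) (sym (ℕ.+-suc s k)) ⟩
    + ((M ℕ.+ s) C (s ℕ.+ suc k)) ∎
    where
    open ≡-Reasoning
    cancel : ∀ a b → a + b - a ≡ b
    cancel = solve-∀

  sign-suc : ∀ j → sign (suc j) ≡ - sign j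
  sign-suc j = ℤ.-1*i≡-i (sign j)

  ∸-suc : ∀ {i k} → i < k → k ∸ i ≡ suc (k ∸ suc i)
  ∸-suc {zero}  {suc k} _         = refl
  ∸-suc {suc i} {suc k} (s≤s i<k) = ∸-suc i<k

  binomialSum : ℕ → (ℕ → ℤ) → ℤ
  binomialSum k f = ∑[ i < suc k ] sign (k ∸ i) * (+ (k C i) * f i)

  binomialSum-suc : ∀ k f → binomialSum (suc k) f ≡ binomialSum k (f ∘ suc) - binomialSum k f
  binomialSum-suc k f = begin
    sign (suc k) * (+ 1 * f 0) + (∑[ i < suc k ] sign (k ∸ i) * (+ (suc k C suc i) * f (suc i)))
      ≡⟨ cong (λ x → sign (suc k) * (+ 1 * f 0) + x)
              (trans (∑-cong (suc k) (λ i _ → split i)) (∑-+ (suc k) (λ i → sign (k ∸ i) * (+ (k C i) * f (suc i))) upper)) ⟩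
    sign (suc k) * (+ 1 * f 0) + (binomialSum k (f ∘ suc) + ∑ (suc k) upper)
      ≡⟨ cong (λ x → sign (suc k) * (+ 1 * f 0) + (binomialSum k (f ∘ suc) + x)) upper-sum ⟩
    sign (suc k) * (+ 1 * f 0) + (binomialSum k (f ∘ suc) + - ∑ k shifted)
      ≡⟨ cong (λ x → x * (+ 1 * f 0) + (binomialSum k (f ∘ suc) + - ∑ k shifted)) (sign-suc k) ⟩
    - sign k * (+ 1 * f 0) + (binomialSum k (f ∘ suc) + - ∑ k shifted)
      ≡⟨ collect (sign k) (+ 1 * f 0) (binomialSum k (f ∘ suc)) (∑ k shifted) ⟩
    binomialSum k (f ∘ suc) - binomialSum k f ∎
    where
    open ≡-Reasoning
    upper shifted : ℕ → ℤ
    upper   i = sign (k ∸ i) * (+ (k C suc i) * f (suc i))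
    shifted i = sign (k ∸ suc i) * (+ (k C suc i) * f (suc i))
    split : ∀ i → sign (k ∸ i) * (+ (suc k C suc i) * f (suc i))
                ≡ sign (k ∸ i) * (+ (k C i) * f (suc i)) + upper i
    split i = trans (cong (λ c → sign (k ∸ i) * (+ c * f (suc i))) ([n+1]C[k+1]≡nCk+nC[k+1] k i))
                    (trans (cong (λ c → sign (k ∸ i) * (c * f (suc i))) (ℤ.pos-+ (k C i) (k C suc i)))
                           (distrib (sign (k ∸ i)) (+ (k C i)) (+ (k C suc i)) (f (suc i))))
      where
      distrib : ∀ a b c d → a * ((b + c) * d) ≡ a * (b * d) + a * (c * d)
      distrib = solve-∀
    upper-sum : ∑ (suc k) upper ≡ - ∑ k shifted
    upper-sum = begin
      ∑ (suc k) upper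
        ≡⟨ ∑-snoc k upper ⟩
      ∑ k upper + upper k
        ≡⟨ cong (λ x → ∑ k upper + sign (k ∸ k) * (+ x * f (suc k))) (k>n⇒nCk≡0 (ℕ.n<1+n k)) ⟩
      ∑ k upper + sign (k ∸ k) * (+ 0 * f (suc k))
        ≡⟨ vanish (∑ k upper) (sign (k ∸ k)) (f (suc k)) ⟩
      ∑ k upper
        ≡⟨ ∑-cong k (λ i i<k → trans (cong (λ j → sign j * (+ (k C suc i) * f (suc i))) (∸-suc i<k))
                                     (trans (cong (_* (+ (k C suc i) * f (suc i))) (sign-suc (k ∸ suc i)))
                                            (sym (ℤ.neg-distribˡ-* (sign (k ∸ suc i)) _)))) ⟩
      ∑[ i < k ] (- shifted i)
        ≡⟨ ∑-neg k shifted ⟩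
      - ∑ k shifted ∎
      where
      vanish : ∀ a s x → a + s * (+ 0 * x) ≡ a
      vanish = solve-∀
    collect : ∀ s x b c → (- s) * x + (b + - c) ≡ b - (s * x + c)
    collect = solve-∀

  Δ^≡binomialSum : ∀ k f → Δ^ k f ≡ binomialSum k f
  Δ^≡binomialSum zero    f = sym (unit (f 0))
    where
    unit : ∀ x → + 1 * (+ 1 * x) + 0ℤ ≡ x
    unit = solve-∀
  Δ^≡binomialSum (suc k) f =
    trans (cong₂ _-_ (Δ^≡binomialSum k (f ∘ suc)) (Δ^≡binomialSum k f)) (sym (binomialSum-suc k f))

module RationalCasts where

  open import Defs
  open import Data.Nat as ℕ using (suc; NonZero)
  import Data.Nat.Properties as ℕ
  open import Data.Integer as ℤ using (ℤ; +_)
  import Data.Integer.Properties as ℤ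
  open import Data.Integer.Tactic.RingSolver using (solve-∀)
  open import Data.Rational using (_/_; _+_; _*_; 1ℚ; toℚᵘ)
  open import Data.Rational.Properties
    using (toℚᵘ-fromℚᵘ; fromℚᵘ-cong; toℚᵘ-injective; toℚᵘ-homo-+; toℚᵘ-homo-*)
  open import Data.Rational.Unnormalised as ℚᵘ using (mkℚᵘ; *≡*) renaming (_≃_ to _≃ᵘ_)
  open import Data.Rational.Unnormalised.Properties using (≃-trans; ≃-sym; +-cong; *-cong)
  open import Relation.Binary.PropositionalEquality using (_≡_; sym; trans; cong)

  toℚᵘ-/ : ∀ x d .{{_ : NonZero d}} → toℚᵘ (x / d) ≃ᵘ mkℚᵘ x (ℕ.pred d)
  toℚᵘ-/ x (suc d) = toℚᵘ-fromℚᵘ (mkℚᵘ x d)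

  /-cross : ∀ x y a b .{{_ : NonZero a}} .{{_ : NonZero b}} → x ℤ.* + b ≡ y ℤ.* + a → x / a ≡ y / b
  /-cross x y (suc a) (suc b) eq = fromℚᵘ-cong {mkℚᵘ x a} {mkℚᵘ y b} (*≡* eq)

  /-* : ∀ x y a b .{{_ : NonZero a}} .{{_ : NonZero b}} →
        (x / a) * (y / b) ≡ ((x ℤ.* y) / (a ℕ.* b)) {{ℕ.m*n≢0 a b}}
  /-* x y (suc a) (suc b) = toℚᵘ-injective
    (≃-trans (toℚᵘ-homo-* (x / suc a) (y / suc b))
    (≃-trans (*-cong (toℚᵘ-/ x (suc a)) (toℚᵘ-/ y (suc b)))
             (≃-sym (toℚᵘ-/ (x ℤ.* y) (suc a ℕ.* suc b)))))

  ℤ→ℚ-* : ∀ x y → ℤ→ℚ (x ℤ.* y) ≡ ℤ→ℚ x * ℤ→ℚ y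
  ℤ→ℚ-* x y = sym (/-* x y 1 1)

  ℤ→ℚ-+ : ∀ x y → ℤ→ℚ (x ℤ.+ y) ≡ ℤ→ℚ x + ℤ→ℚ y
  ℤ→ℚ-+ x y = toℚᵘ-injective
    (≃-trans (toℚᵘ-/ (x ℤ.+ y) 1)
    (≃-trans (*≡* (cross x y))
    (≃-sym (≃-trans (toℚᵘ-homo-+ (ℤ→ℚ x) (ℤ→ℚ y)) (+-cong (toℚᵘ-/ x 1) (toℚᵘ-/ y 1))))))
    where
    cross : ∀ x y → (x ℤ.+ y) ℤ.* + 1 ≡ (x ℤ.* + 1 ℤ.+ y ℤ.* + 1) ℤ.* + 1
    cross = solve-∀

  ℕ→ℚ-+ : ∀ m n → ℕ→ℚ (m ℕ.+ n) ≡ ℕ→ℚ m + ℕ→ℚ n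
  ℕ→ℚ-+ m n = trans (cong ℤ→ℚ (ℤ.pos-+ m n)) (ℤ→ℚ-+ (+ m) (+ n))

  ℕ→ℚ-* : ∀ m n → ℕ→ℚ (m ℕ.* n) ≡ ℕ→ℚ m * ℕ→ℚ n
  ℕ→ℚ-* m n = trans (cong ℤ→ℚ (ℤ.pos-* m n)) (ℤ→ℚ-* (+ m) (+ n))

  ℕ→ℚ-suc : ∀ n → ℕ→ℚ (suc n) ≡ ℕ→ℚ n + 1ℚ
  ℕ→ℚ-suc n = trans (cong ℕ→ℚ (ℕ.+-comm 1 n)) (ℕ→ℚ-+ n 1)

module CompanionCoefficients where

  open import Defs
  open import Data.Nat as ℕ using (ℕ; zero; suc; _∸_; _≤_; _!)
  import Data.Nat.Properties as ℕ
  open import Data.Nat.Properties using (_!≢0)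
  open import Data.Nat.Combinatorics using (_C_)
  open import Data.Integer as ℤ using (ℤ; +_)
  import Data.Integer.Properties as ℤ
  open import Data.Integer.Tactic.RingSolver using (solve-∀)
  open import Data.Rational using (ℚ; _/_; _+_; _*_; _-_; 1ℚ)
  open import Data.Rational.Properties using (*-distribʳ-+; *-assoc)
  open RationalRing using (ℚ-ring)
  import Tactic.RingSolver as RingSolver
  open import Relation.Binary.PropositionalEquality
  open Binomial using (k!*[n∸k]!*nCk≡n!; [k+1]*nC[k+1]+k*nCk≡n*nCk)
  open RationalCasts
  open FiniteDifferences using (∑; ∑-snoc; sign; binomialSum)

  w : ℕ → ℚ
  w k = ((+ 1) / k !) {{k !≢0}}

  w-step : ∀ k → w k ≡ ℕ→ℚ (suc k) * w (suc k)
  w-step k = sym (trans (/-* (+ suc k) (+ 1) 1 (suc k !) {{_}} {{suc k !≢0}})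
    (/-cross (+ suc k ℤ.* + 1) (+ 1) (1 ℕ.* suc k !) (k !)
             {{ℕ.m*n≢0 1 (suc k !) {{_}} {{suc k !≢0}}}} {{k !≢0}} (cross (suc k) (k !))))
    where
    cross : ∀ m f → (+ m ℤ.* + 1) ℤ.* + f ≡ + 1 ℤ.* + (1 ℕ.* (m ℕ.* f))
    cross m f = begin
      (+ m ℤ.* + 1) ℤ.* + f    ≡⟨ reassociate (+ m) (+ f) ⟩
      + 1 ℤ.* (+ m ℤ.* + f)    ≡⟨ cong (+ 1 ℤ.*_) (sym (ℤ.pos-* m f)) ⟩
      + 1 ℤ.* + (m ℕ.* f)      ≡⟨ cong (λ x → + 1 ℤ.* + x) (sym (ℕ.*-identityˡ (m ℕ.* f))) ⟩
      + 1 ℤ.* + (1 ℕ.* (m ℕ.* f)) ∎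
      where
      open ≡-Reasoning
      reassociate : ∀ m f → (m ℤ.* + 1) ℤ.* f ≡ + 1 ℤ.* (m ℤ.* f)
      reassociate = solve-∀

  cauchy-term : ∀ (S : ℕ → ℕ) k i → i ≤ k →
    egf S i * expNeg (k ∸ i) ≡ ℤ→ℚ (sign (k ∸ i) ℤ.* (+ (k C i) ℤ.* + S i)) * w k
  cauchy-term S k i i≤k =
    trans (/-* (+ S i) (sign (k ∸ i)) (i !) ((k ∸ i) !) {{i !≢0}} {{(k ∸ i) !≢0}})
   (trans (/-cross (+ S i ℤ.* sign (k ∸ i)) (sign (k ∸ i) ℤ.* (+ (k C i) ℤ.* + S i) ℤ.* + 1)
                   (i ! ℕ.* (k ∸ i) !) (1 ℕ.* k !) {{ℕ.m*n≢0 (i !) ((k ∸ i) !) {{i !≢0}} {{(k ∸ i) !≢0}}}} {{ℕ.m*n≢0 1 (k !) {{_}} {{k !≢0}}}} cross)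
          (sym (/-* (sign (k ∸ i) ℤ.* (+ (k C i) ℤ.* + S i)) (+ 1) 1 (k !) {{_}} {{k !≢0}})))
    where
    cross : (+ S i ℤ.* sign (k ∸ i)) ℤ.* + (1 ℕ.* k !)
              ≡ (sign (k ∸ i) ℤ.* (+ (k C i) ℤ.* + S i) ℤ.* + 1) ℤ.* + (i ! ℕ.* (k ∸ i) !)
    cross = begin
      (+ S i ℤ.* sign (k ∸ i)) ℤ.* + (1 ℕ.* k !)
        ≡⟨ cong (λ x → (+ S i ℤ.* sign (k ∸ i)) ℤ.* + x)
                (trans (ℕ.*-identityˡ (k !)) (sym (k!*[n∸k]!*nCk≡n! i≤k))) ⟩
      (+ S i ℤ.* sign (k ∸ i)) ℤ.* + (i ! ℕ.* (k ∸ i) ! ℕ.* (k C i))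
        ≡⟨ cong ((+ S i ℤ.* sign (k ∸ i)) ℤ.*_)
                (trans (ℤ.pos-* (i ! ℕ.* (k ∸ i) !) (k C i)) (cong (ℤ._* + (k C i)) (ℤ.pos-* (i !) ((k ∸ i) !)))) ⟩
      (+ S i ℤ.* sign (k ∸ i)) ℤ.* (+ (i !) ℤ.* + ((k ∸ i) !) ℤ.* + (k C i))
        ≡⟨ regroup (+ S i) (sign (k ∸ i)) (+ (i !)) (+ ((k ∸ i) !)) (+ (k C i)) ⟩
      (sign (k ∸ i) ℤ.* (+ (k C i) ℤ.* + S i) ℤ.* + 1) ℤ.* (+ (i !) ℤ.* + ((k ∸ i) !))
        ≡⟨ cong ((sign (k ∸ i) ℤ.* (+ (k C i) ℤ.* + S i) ℤ.* + 1) ℤ.*_) (sym (ℤ.pos-* (i !) ((k ∸ i) !))) ⟩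
      (sign (k ∸ i) ℤ.* (+ (k C i) ℤ.* + S i) ℤ.* + 1) ℤ.* + (i ! ℕ.* (k ∸ i) !) ∎
      where
      open ≡-Reasoning
      regroup : ∀ s σ a b c → (s ℤ.* σ) ℤ.* (a ℤ.* b ℤ.* c) ≡ (σ ℤ.* (c ℤ.* s) ℤ.* + 1) ℤ.* (a ℤ.* b)
      regroup = solve-∀

  sumTo-∑ : ∀ k (f : ℕ → ℚ) (t : ℕ → ℤ) W → (∀ i → i ≤ k → f i ≡ ℤ→ℚ (t i) * W) →
            sumTo k f ≡ ℤ→ℚ (∑ (suc k) t) * W
  sumTo-∑ zero    f t W eq = trans (eq 0 ℕ.z≤n) (cong (λ x → ℤ→ℚ x * W) (sym (ℤ.+-identityʳ (t 0))))
  sumTo-∑ (suc k) f t W eq = begin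
    sumTo k f + f (suc k)
      ≡⟨ cong₂ _+_ (sumTo-∑ k f t W (λ i i≤k → eq i (ℕ.m≤n⇒m≤1+n i≤k))) (eq (suc k) ℕ.≤-refl) ⟩
    ℤ→ℚ (∑ (suc k) t) * W + ℤ→ℚ (t (suc k)) * W
      ≡⟨ sym (*-distribʳ-+ W (ℤ→ℚ (∑ (suc k) t)) (ℤ→ℚ (t (suc k)))) ⟩
    (ℤ→ℚ (∑ (suc k) t) + ℤ→ℚ (t (suc k))) * W
      ≡⟨ cong (_* W) (sym (ℤ→ℚ-+ (∑ (suc k) t) (t (suc k)))) ⟩
    ℤ→ℚ (∑ (suc k) t ℤ.+ t (suc k)) * W
      ≡⟨ cong (λ x → ℤ→ℚ x * W) (sym (∑-snoc (suc k) t)) ⟩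
    ℤ→ℚ (∑ (suc (suc k)) t) * W ∎
    where open ≡-Reasoning

  companion-coefficient : ∀ S k → (egf S ⊛ expNeg) k ≡ ℤ→ℚ (binomialSum k (λ i → + S i)) * w k
  companion-coefficient S k =
    sumTo-∑ k _ (λ i → sign (k ∸ i) ℤ.* (+ (k C i) ℤ.* + S i)) (w k) (cauchy-term S k)

  binomialTerm : ℕ → ℕ → ℚ
  binomialTerm N r = ℕ→ℚ (N C r) * w r

  binomialTerm-kummer : ∀ N r → let x = ℕ→ℚ r in
    (x + 1ℚ) * (x + 1ℚ) * binomialTerm N (suc r) ≡ (ℕ→ℚ N - x) * binomialTerm N r
  binomialTerm-kummer N r = begin
    (x + 1ℚ) * (x + 1ℚ) * (ℕ→ℚ (N C suc r) * w (suc r))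
      ≡⟨ regroup (x + 1ℚ) (ℕ→ℚ (N C suc r)) (w (suc r)) ⟩
    ((x + 1ℚ) * ℕ→ℚ (N C suc r)) * ((x + 1ℚ) * w (suc r))
      ≡⟨ cong₂ _*_ absorb (trans (cong (_* w (suc r)) (sym (ℕ→ℚ-suc r))) (sym (w-step r))) ⟩
    ((ℕ→ℚ N - x) * ℕ→ℚ (N C r)) * w r
      ≡⟨ *-assoc (ℕ→ℚ N - x) (ℕ→ℚ (N C r)) (w r) ⟩
    (ℕ→ℚ N - x) * (ℕ→ℚ (N C r) * w r) ∎
    where
    open ≡-Reasoning
    x = ℕ→ℚ r
    regroup : ∀ y c v → y * y * (c * v) ≡ (y * c) * (y * v)
    regroup = RingSolver.solve-∀ ℚ-ring
    c = ℕ→ℚ (N C r)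
    c′ = ℕ→ℚ (N C suc r)
    absorbℕ : ℕ→ℚ (suc r) * c′ + x * c ≡ ℕ→ℚ N * c
    absorbℕ = begin
      ℕ→ℚ (suc r) * c′ + x * c               ≡⟨ sym (cong₂ _+_ (ℕ→ℚ-* (suc r) (N C suc r)) (ℕ→ℚ-* r (N C r))) ⟩
      ℕ→ℚ (suc r ℕ.* (N C suc r)) + ℕ→ℚ (r ℕ.* (N C r)) ≡⟨ sym (ℕ→ℚ-+ (suc r ℕ.* (N C suc r)) (r ℕ.* (N C r))) ⟩
      ℕ→ℚ (suc r ℕ.* (N C suc r) ℕ.+ r ℕ.* (N C r))   ≡⟨ cong ℕ→ℚ ([k+1]*nC[k+1]+k*nCk≡n*nCk N r) ⟩
      ℕ→ℚ (N ℕ.* (N C r))                   ≡⟨ ℕ→ℚ-* N (N C r) ⟩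
      ℕ→ℚ N * c                              ∎
    absorb : (x + 1ℚ) * c′ ≡ (ℕ→ℚ N - x) * c
    absorb = begin
      (x + 1ℚ) * c′                        ≡⟨ cong (_* c′) (sym (ℕ→ℚ-suc r)) ⟩
      ℕ→ℚ (suc r) * c′                     ≡⟨ add-sub (ℕ→ℚ (suc r) * c′) (x * c) ⟩
      (ℕ→ℚ (suc r) * c′ + x * c) - x * c   ≡⟨ cong (_- x * c) absorbℕ ⟩
      ℕ→ℚ N * c - x * c                    ≡⟨ factor (ℕ→ℚ N) x c ⟩
      (ℕ→ℚ N - x) * c                      ∎
      where
      add-sub : ∀ u v → u ≡ (u + v) - v
      add-sub = RingSolver.solve-∀ ℚ-ring
      factor : ∀ N x c → N * c - x * c ≡ (N - x) * c
      factor = RingSolver.solve-∀ ℚ-ring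

module SecondOrderOperator where

  open import Defs
  open import Data.Nat as ℕ using (ℕ; zero; suc)
  open import Data.Rational using (ℚ; 0ℚ; 1ℚ; _+_; _*_; _-_; 1/_; Positive)
  open import Data.Rational.Properties using (normalize-pos; pos*pos⇒pos; *-zeroˡ; *-zeroʳ; *-inverseˡ; *-assoc; *-identityˡ; pos⇒nonZero)
  open import Relation.Binary.PropositionalEquality using (_≡_; refl; sym; trans; cong; cong₂; subst; module ≡-Reasoning)
  open RationalRing using (ℚ-ring)
  open import Tactic.RingSolver using (solve-∀)

  open RationalCasts using (ℕ→ℚ-suc)

  operator : (a b c d : ℚ) → PS → PS
  operator a b c d Y =
    let Y′ = D Y
        Y″ = D (D Y)
    in ((a · mulX (mulX Y″)) ⊕ (b · mulX Y″))
       ⊕ (((a · mulX (mulX Y′)) ⊕ (b · mulX Y′)) ⊕ (b · Y′))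
       ⊕ ((c · mulX Y) ⊕ ((0ℚ - d) · Y))

  mulX-D : ∀ Y k → mulX (D Y) k ≡ ℕ→ℚ k * Y k
  mulX-D Y zero    = sym (*-zeroˡ (Y 0))
  mulX-D Y (suc k) = refl

  *-cancelˡ-≡0 : ∀ p .{{_ : Positive p}} x → p * x ≡ 0ℚ → x ≡ 0ℚ
  *-cancelˡ-≡0 p x px≡0 = begin
    x                 ≡⟨ sym (*-identityˡ x) ⟩
    1ℚ * x            ≡⟨ cong (_* x) (sym (*-inverseˡ p)) ⟩
    (1/ p * p) * x    ≡⟨ *-assoc (1/ p) p x ⟩
    1/ p * (p * x)    ≡⟨ cong (1/ p *_) px≡0 ⟩
    1/ p * 0ℚ         ≡⟨ *-zeroʳ (1/ p) ⟩
    0ℚ                ∎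
    where
    open ≡-Reasoning
    instance _ = pos⇒nonZero p

  module _ (a b c d : ℚ) (Y : PS) where

    operator-zero : operator a b c d Y 0 ≡ b * Y 1 - d * Y 0
    operator-zero = unfold a b c d (Y 0) (Y 1)
      where
      unfold : ∀ a b c d y₀ y₁ →
        ((a * 0ℚ + b * 0ℚ) + ((a * 0ℚ + b * 0ℚ) + b * (ℕ→ℚ 1 * y₁))) + (c * 0ℚ + (0ℚ - d) * y₀)
          ≡ b * y₁ - d * y₀
      unfold = solve-∀ ℚ-ring

    operator-suc : ∀ j → let x = ℕ→ℚ j in
      operator a b c d Y (suc j)
        ≡ b * ((x + 1ℚ + 1ℚ) * (x + 1ℚ + 1ℚ)) * Y (2 ℕ.+ j)
          + (a * x * (x + 1ℚ) + b * (x + 1ℚ) - d) * Y (suc j)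
          + (a * x + c) * Y j
    operator-suc j = begin
      operator a b c d Y (suc j)
        ≡⟨ cong₂ (λ u v → ((a * u + b * (J * (J′ * Y (2 ℕ.+ j)))) + ((a * v + b * (J * Y (suc j)))
                            + b * (J′ * Y (2 ℕ.+ j)))) + (c * Y j + (0ℚ - d) * Y (suc j)))
                 (mulX-D (D Y) j) (mulX-D Y j) ⟩
      ((a * (x * (J * Y (suc j))) + b * (J * (J′ * Y (2 ℕ.+ j))))
        + ((a * (x * Y j) + b * (J * Y (suc j))) + b * (J′ * Y (2 ℕ.+ j))))
        + (c * Y j + (0ℚ - d) * Y (suc j))
        ≡⟨ cong₂ (λ u v → ((a * (x * (u * Y (suc j))) + b * (u * (v * Y (2 ℕ.+ j))))
                            + ((a * (x * Y j) + b * (u * Y (suc j))) + b * (v * Y (2 ℕ.+ j))))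
                            + (c * Y j + (0ℚ - d) * Y (suc j)))
                 (ℕ→ℚ-suc j) (trans (ℕ→ℚ-suc (suc j)) (cong (_+ 1ℚ) (ℕ→ℚ-suc j))) ⟩
      _ ≡⟨ collect a b c d x (Y j) (Y (suc j)) (Y (2 ℕ.+ j)) ⟩
      _ ∎
      where
      open ≡-Reasoning
      x = ℕ→ℚ j
      J = ℕ→ℚ (suc j)
      J′ = ℕ→ℚ (2 ℕ.+ j)
      collect : ∀ a b c d x y₀ y₁ y₂ →
        ((a * (x * ((x + 1ℚ) * y₁)) + b * ((x + 1ℚ) * ((x + 1ℚ + 1ℚ) * y₂)))
          + ((a * (x * y₀) + b * ((x + 1ℚ) * y₁)) + b * ((x + 1ℚ + 1ℚ) * y₂)))
          + (c * y₀ + (0ℚ - d) * y₁)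
        ≡ b * ((x + 1ℚ + 1ℚ) * (x + 1ℚ + 1ℚ)) * y₂ + (a * x * (x + 1ℚ) + b * (x + 1ℚ) - d) * y₁ + (a * x + c) * y₀
      collect = solve-∀ ℚ-ring

  module _ (a b c d N : ℚ) (q : ℕ → ℚ)
    (q-initial : b * N * q 1 ≡ d * q 0)
    (q-step : ∀ j →
       b * (N - (ℕ→ℚ j + 1ℚ)) * (N - ℕ→ℚ j) * q (2 ℕ.+ j)
       + (a * ℕ→ℚ j * (ℕ→ℚ j + 1ℚ) + b * (ℕ→ℚ j + 1ℚ) - d) * (N - ℕ→ℚ j) * q (suc j)
       + (a * ℕ→ℚ j + c) * ((ℕ→ℚ j + 1ℚ) * (ℕ→ℚ j + 1ℚ)) * q j ≡ 0ℚ)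
    (s : ℕ → ℚ)
    (s-kummer : ∀ r → (ℕ→ℚ r + 1ℚ) * (ℕ→ℚ r + 1ℚ) * s (suc r) ≡ (N - ℕ→ℚ r) * s r)
    (μ : ℚ) .{{_ : Positive μ}} (Y : PS) (Y≈sq : ∀ r → μ * Y r ≡ s r * q r)
    where

    annihilates : ∀ k → operator a b c d Y k ≡ 0ℚ
    annihilates zero = *-cancelˡ-≡0 μ _ (begin
      μ * operator a b c d Y 0      ≡⟨ cong (μ *_) (operator-zero a b c d Y) ⟩
      μ * (b * Y 1 - d * Y 0)       ≡⟨ expand b d μ (Y 0) (Y 1) ⟩
      b * (μ * Y 1) - d * (μ * Y 0) ≡⟨ cong₂ (λ u v → b * u - d * v) (Y≈sq 1) (Y≈sq 0) ⟩
      b * (s 1 * q 1) - d * (s 0 * q 0) ≡⟨ cong (λ u → b * (u * q 1) - d * (s 0 * q 0)) s₁ ⟩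
      b * (N * s 0 * q 1) - d * (s 0 * q 0) ≡⟨ factor b d N (s 0) (q 0) (q 1) ⟩
      s 0 * (b * N * q 1 - d * q 0) ≡⟨ cong (λ u → s 0 * (u - d * q 0)) q-initial ⟩
      s 0 * (d * q 0 - d * q 0)     ≡⟨ cancel (s 0) (d * q 0) ⟩
      0ℚ                            ∎)
      where
      open ≡-Reasoning
      s₁ : s 1 ≡ N * s 0
      s₁ = trans (sym (unit (s 1))) (trans (s-kummer 0) (cong (_* s 0) (minus-zero N)))
        where
        unit : ∀ y → (ℕ→ℚ 0 + 1ℚ) * (ℕ→ℚ 0 + 1ℚ) * y ≡ y
        unit = solve-∀ ℚ-ring
        minus-zero : ∀ N → N - ℕ→ℚ 0 ≡ N
        minus-zero = solve-∀ ℚ-ring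
      expand : ∀ b d μ y₀ y₁ → μ * (b * y₁ - d * y₀) ≡ b * (μ * y₁) - d * (μ * y₀)
      expand = solve-∀ ℚ-ring
      factor : ∀ b d N s₀ q₀ q₁ → b * (N * s₀ * q₁) - d * (s₀ * q₀) ≡ s₀ * (b * N * q₁ - d * q₀)
      factor = solve-∀ ℚ-ring
      cancel : ∀ s u → s * (u - u) ≡ 0ℚ
      cancel = solve-∀ ℚ-ring
    -- Eliminating Y, s (2 + j) and s (1 + j) leaves s j times the left side of q-step.
    annihilates (suc j) = *-cancelˡ-≡0 (μ * (J * J)) _ (begin
      μ * (J * J) * operator a b c d Y (suc j)
        ≡⟨ cong₂ (λ u v → μ * (u * u) * v) (ℕ→ℚ-suc j) (operator-suc a b c d Y j) ⟩
      μ * (x₁ * x₁) * (b * (x₂ * x₂) * Y (2 ℕ.+ j) + B * Y (suc j) + C * Y j)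
        ≡⟨ distribute μ b B C x₁ x₂ (Y j) (Y (suc j)) (Y (2 ℕ.+ j)) ⟩
      x₁ * x₁ * (b * (x₂ * x₂) * (μ * Y (2 ℕ.+ j)) + B * (μ * Y (suc j)) + C * (μ * Y j))
        ≡⟨ cong₂ (λ u v → x₁ * x₁ * (u + C * v))
                 (cong₂ (λ u v → b * (x₂ * x₂) * u + B * v) (Y≈sq (2 ℕ.+ j)) (Y≈sq (suc j))) (Y≈sq j) ⟩
      x₁ * x₁ * (b * (x₂ * x₂) * (s₂ * q₂) + B * (s₁ * q₁) + C * (s₀ * q₀))
        ≡⟨ regroup₂ b B C x₁ x₂ s₀ s₁ s₂ q₀ q₁ q₂ ⟩
      b * q₂ * (x₁ * x₁) * (x₂ * x₂ * s₂) + B * q₁ * (x₁ * x₁ * s₁) + C * (x₁ * x₁) * (s₀ * q₀)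
        ≡⟨ cong (λ u → b * q₂ * (x₁ * x₁) * u + B * q₁ * (x₁ * x₁ * s₁) + C * (x₁ * x₁) * (s₀ * q₀))
                kummer₂ ⟩
      b * q₂ * (x₁ * x₁) * ((N - x₁) * s₁) + B * q₁ * (x₁ * x₁ * s₁) + C * (x₁ * x₁) * (s₀ * q₀)
        ≡⟨ regroup₁ b B C N x₁ s₀ s₁ q₀ q₁ q₂ ⟩
      (b * q₂ * (N - x₁) + B * q₁) * (x₁ * x₁ * s₁) + C * (x₁ * x₁) * (s₀ * q₀)
        ≡⟨ cong (λ u → (b * q₂ * (N - x₁) + B * q₁) * u + C * (x₁ * x₁) * (s₀ * q₀)) (s-kummer j) ⟩
      (b * q₂ * (N - x₁) + B * q₁) * ((N - x) * s₀) + C * (x₁ * x₁) * (s₀ * q₀)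
        ≡⟨ factor b B C N x x₁ s₀ q₀ q₁ q₂ ⟩
      s₀ * (b * (N - x₁) * (N - x) * q₂ + B * (N - x) * q₁ + C * (x₁ * x₁) * q₀)
        ≡⟨ cong (s₀ *_) (q-step j) ⟩
      s₀ * 0ℚ
        ≡⟨ *-zeroʳ s₀ ⟩
      0ℚ ∎)
      where
      open ≡-Reasoning
      J = ℕ→ℚ (suc j)
      x = ℕ→ℚ j
      x₁ = x + 1ℚ
      x₂ = x₁ + 1ℚ
      B = a * x * x₁ + b * x₁ - d
      C = a * x + c
      s₀ = s j
      s₁ = s (suc j)
      s₂ = s (2 ℕ.+ j)
      q₀ = q j
      q₁ = q (suc j)
      q₂ = q (2 ℕ.+ j)
      instance
        _ = normalize-pos (suc j) 1
        _ = pos*pos⇒pos J J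
        _ = pos*pos⇒pos μ (J * J)
      kummer₂ : x₂ * x₂ * s₂ ≡ (N - x₁) * s₁
      kummer₂ = subst (λ u → (u + 1ℚ) * (u + 1ℚ) * s₂ ≡ (N - u) * s₁) (ℕ→ℚ-suc j) (s-kummer (suc j))
      distribute : ∀ μ b B C x₁ x₂ y₀ y₁ y₂ →
        μ * (x₁ * x₁) * (b * (x₂ * x₂) * y₂ + B * y₁ + C * y₀)
          ≡ x₁ * x₁ * (b * (x₂ * x₂) * (μ * y₂) + B * (μ * y₁) + C * (μ * y₀))
      distribute = solve-∀ ℚ-ring
      regroup₂ : ∀ b B C x₁ x₂ s₀ s₁ s₂ q₀ q₁ q₂ →
        x₁ * x₁ * (b * (x₂ * x₂) * (s₂ * q₂) + B * (s₁ * q₁) + C * (s₀ * q₀))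
          ≡ b * q₂ * (x₁ * x₁) * (x₂ * x₂ * s₂) + B * q₁ * (x₁ * x₁ * s₁) + C * (x₁ * x₁) * (s₀ * q₀)
      regroup₂ = solve-∀ ℚ-ring
      regroup₁ : ∀ b B C N x₁ s₀ s₁ q₀ q₁ q₂ →
        b * q₂ * (x₁ * x₁) * ((N - x₁) * s₁) + B * q₁ * (x₁ * x₁ * s₁) + C * (x₁ * x₁) * (s₀ * q₀)
          ≡ (b * q₂ * (N - x₁) + B * q₁) * (x₁ * x₁ * s₁) + C * (x₁ * x₁) * (s₀ * q₀)
      regroup₁ = solve-∀ ℚ-ring
      factor : ∀ b B C N x x₁ s₀ q₀ q₁ q₂ →
        (b * q₂ * (N - x₁) + B * q₁) * ((N - x) * s₀) + C * (x₁ * x₁) * (s₀ * q₀)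
          ≡ s₀ * (b * (N - x₁) * (N - x) * q₂ + B * (N - x) * q₁ + C * (x₁ * x₁) * q₀)
      factor = solve-∀ ℚ-ring

module CatalanPolynomial where

  open import Defs
  open import Data.Nat as ℕ using (ℕ; suc)
  import Data.Nat.Properties as ℕ
  open import Data.Nat.Combinatorics using (_C_)
  open import Data.Integer as ℤ using (ℤ; +_)
  import Data.Integer.Properties as ℤ
  open import Data.Rational using (ℚ; 0ℚ; 1ℚ; _+_; _*_; _-_; Positive)
  open import Data.Rational.Properties using (normalize-pos)
  open import Relation.Binary.PropositionalEquality
  open import Function using (_∘_)
  open RationalRing using (ℚ-ring)
  open import Tactic.RingSolver using (solve-∀)
  open import Data.Nat.Tactic.RingSolver renaming (solve-∀ to ℕ-solve-∀)
  open Binomial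
  open BallotNumbers
  open FiniteDifferences
  open RationalCasts
  open CompanionCoefficients
  open LadderCount using (σ-ladder)
  open SecondOrderOperator

  module CatalanOperator (m : ℚ) where

    a b c d degree : ℚ
    a = ℕ→ℚ 3 * (m + ℕ→ℚ 1)
    b = ℕ→ℚ 8 * ((ℕ→ℚ 2 * m - ℕ→ℚ 1) * (ℕ→ℚ 2 * m - ℕ→ℚ 1))
    c = ℕ→ℚ 6 * (m + ℕ→ℚ 1) * (ℕ→ℚ 1 - m)
    d = ℕ→ℚ 4 * (ℕ→ℚ 2 * m - ℕ→ℚ 1) * (ℕ→ℚ 8 * m * m - ℕ→ℚ 13 * m + ℕ→ℚ 3)
    degree = ℕ→ℚ 2 * m - ℕ→ℚ 2

    Q : ℚ → ℚ
    Q x = ℕ→ℚ 4 * (m - ℕ→ℚ 1) * (ℕ→ℚ 2 * m - ℕ→ℚ 1) - (m + ℕ→ℚ 1) * x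

    Q-initial : b * degree * Q (ℕ→ℚ 1) ≡ d * Q (ℕ→ℚ 0)
    Q-initial = identity m
      where
      identity : ∀ m →
        let b = ℕ→ℚ 8 * ((ℕ→ℚ 2 * m - ℕ→ℚ 1) * (ℕ→ℚ 2 * m - ℕ→ℚ 1))
            d = ℕ→ℚ 4 * (ℕ→ℚ 2 * m - ℕ→ℚ 1) * (ℕ→ℚ 8 * m * m - ℕ→ℚ 13 * m + ℕ→ℚ 3)
            Q = λ x → ℕ→ℚ 4 * (m - ℕ→ℚ 1) * (ℕ→ℚ 2 * m - ℕ→ℚ 1) - (m + ℕ→ℚ 1) * x
        in b * (ℕ→ℚ 2 * m - ℕ→ℚ 2) * Q (ℕ→ℚ 1) ≡ d * Q (ℕ→ℚ 0)
      identity = solve-∀ ℚ-ring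

    Q-step : ∀ x →
      b * (degree - (x + 1ℚ)) * (degree - x) * Q (x + 1ℚ + 1ℚ)
      + (a * x * (x + 1ℚ) + b * (x + 1ℚ) - d) * (degree - x) * Q (x + 1ℚ)
      + (a * x + c) * ((x + 1ℚ) * (x + 1ℚ)) * Q x ≡ 0ℚ
    Q-step = identity m
      where
      identity : ∀ m x →
        let a = ℕ→ℚ 3 * (m + ℕ→ℚ 1)
            b = ℕ→ℚ 8 * ((ℕ→ℚ 2 * m - ℕ→ℚ 1) * (ℕ→ℚ 2 * m - ℕ→ℚ 1))
            c = ℕ→ℚ 6 * (m + ℕ→ℚ 1) * (ℕ→ℚ 1 - m)
            d = ℕ→ℚ 4 * (ℕ→ℚ 2 * m - ℕ→ℚ 1) * (ℕ→ℚ 8 * m * m - ℕ→ℚ 13 * m + ℕ→ℚ 3)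
            N = ℕ→ℚ 2 * m - ℕ→ℚ 2
            Q = λ x → ℕ→ℚ 4 * (m - ℕ→ℚ 1) * (ℕ→ℚ 2 * m - ℕ→ℚ 1) - (m + ℕ→ℚ 1) * x
        in b * (N - (x + 1ℚ)) * (N - x) * Q (x + 1ℚ + 1ℚ)
           + (a * x * (x + 1ℚ) + b * (x + 1ℚ) - d) * (N - x) * Q (x + 1ℚ)
           + (a * x + c) * ((x + 1ℚ) * (x + 1ℚ)) * Q x ≡ 0ℚ
      identity = solve-∀ ℚ-ring

  module CatalanSolution (p : ℕ) where

    private
      n = 2 ℕ.+ p
      K = p ℕ.+ (p ℕ.+ 2)
      M = p ℕ.+ (p ℕ.+ 1)
      A = ballot p 2
      B = ballot p 1
      P = ℕ→ℚ p
      m = ℕ→ℚ n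

    companion-closed : ∀ r → Cstar n r ≡ ℤ→ℚ (+ (K C r) ℤ.* + A ℤ.+ + (M C r) ℤ.* + B) * w r
    companion-closed r = begin
      Cstar n r
        ≡⟨ companion-coefficient S r ⟩
      ℤ→ℚ (binomialSum r (λ i → + S i)) * w r
        ≡⟨ cong (λ x → ℤ→ℚ x * w r) (trans (sym (Δ^≡binomialSum r (λ i → + S i))) differences) ⟩
      ℤ→ℚ (+ (K C r) ℤ.* + A ℤ.+ + (M C r) ℤ.* + B) * w r ∎
      where
      open ≡-Reasoning
      S : ℕ → ℕ
      S i = σ (attachTail (Gnn n) 1 i)
      S≡ : ∀ i → + S i ≡ + ((K ℕ.+ i) C i) ℤ.* + A ℤ.+ + ((M ℕ.+ i) C i) ℤ.* + B
      S≡ i = trans (cong +_ (σ-ladder p i))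
                   (trans (ℤ.pos-+ (((K ℕ.+ i) C i) ℕ.* A) (((M ℕ.+ i) C i) ℕ.* B))
                          (cong₂ ℤ._+_ (ℤ.pos-* ((K ℕ.+ i) C i) A) (ℤ.pos-* ((M ℕ.+ i) C i) B)))
      differences : Δ^ r (λ i → + S i) ≡ + (K C r) ℤ.* + A ℤ.+ + (M C r) ℤ.* + B
      differences = begin
        Δ^ r (λ i → + S i)
          ≡⟨ Δ^-cong r S≡ ⟩
        Δ^ r (λ i → + ((K ℕ.+ i) C i) ℤ.* + A ℤ.+ + ((M ℕ.+ i) C i) ℤ.* + B)
          ≡⟨ Δ^-linear r (λ i → + ((K ℕ.+ i) C i)) (λ i → + ((M ℕ.+ i) C i)) (+ A) (+ B) ⟩
        Δ^ r (λ i → + ((K ℕ.+ i) C i)) ℤ.* + A ℤ.+ Δ^ r (λ i → + ((M ℕ.+ i) C i)) ℤ.* + B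
          ≡⟨ cong₂ (λ x y → x ℤ.* + A ℤ.+ y ℤ.* + B)
                   (trans (Δ^-binomial r K 0) (cong (λ k → + (k C r)) (ℕ.+-identityʳ K)))
                   (trans (Δ^-binomial r M 0) (cong (λ k → + (k C r)) (ℕ.+-identityʳ M))) ⟩
        + (K C r) ℤ.* + A ℤ.+ + (M C r) ℤ.* + B ∎

    open CatalanOperator m

    m≡ : m ≡ ℕ→ℚ 2 + P
    m≡ = ℕ→ℚ-+ 2 p

    K≡degree : ℕ→ℚ K ≡ degree
    K≡degree = begin
      ℕ→ℚ (p ℕ.+ (p ℕ.+ 2))      ≡⟨ trans (ℕ→ℚ-+ p (p ℕ.+ 2)) (cong (λ x → P + x) (ℕ→ℚ-+ p 2)) ⟩
      P + (P + ℕ→ℚ 2)            ≡⟨ rearrange P ⟩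
      ℕ→ℚ 2 * (ℕ→ℚ 2 + P) - ℕ→ℚ 2 ≡⟨ cong (λ x → ℕ→ℚ 2 * x - ℕ→ℚ 2) (sym m≡) ⟩
      degree                     ∎
      where
      open ≡-Reasoning
      rearrange : ∀ P → P + (P + ℕ→ℚ 2) ≡ ℕ→ℚ 2 * (ℕ→ℚ 2 + P) - ℕ→ℚ 2
      rearrange = solve-∀ ℚ-ring

    ballot-ratioℚ : (m + ℕ→ℚ 1) * ℕ→ℚ A ≡ ℕ→ℚ 3 * (m - ℕ→ℚ 1) * ℕ→ℚ B
    ballot-ratioℚ = begin
      (m + ℕ→ℚ 1) * ℕ→ℚ A                ≡⟨ cong (λ x → (x + ℕ→ℚ 1) * ℕ→ℚ A) m≡ ⟩
      (ℕ→ℚ 2 + P + ℕ→ℚ 1) * ℕ→ℚ A        ≡⟨ left P (ℕ→ℚ A) ⟩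
      (P + ℕ→ℚ 3) * ℕ→ℚ A                ≡⟨ cong (_* ℕ→ℚ A) (sym (ℕ→ℚ-+ p 3)) ⟩
      ℕ→ℚ (p ℕ.+ 3) * ℕ→ℚ A              ≡⟨ sym (ℕ→ℚ-* (p ℕ.+ 3) A) ⟩
      ℕ→ℚ ((p ℕ.+ 3) ℕ.* A)              ≡⟨ cong ℕ→ℚ (ballot-ratio p) ⟩
      ℕ→ℚ (3 ℕ.* (p ℕ.+ 1) ℕ.* B)        ≡⟨ trans (ℕ→ℚ-* (3 ℕ.* (p ℕ.+ 1)) B) (cong (_* ℕ→ℚ B) (ℕ→ℚ-* 3 (p ℕ.+ 1))) ⟩
      ℕ→ℚ 3 * ℕ→ℚ (p ℕ.+ 1) * ℕ→ℚ B      ≡⟨ cong (λ x → ℕ→ℚ 3 * x * ℕ→ℚ B) (ℕ→ℚ-+ p 1) ⟩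
      ℕ→ℚ 3 * (P + ℕ→ℚ 1) * ℕ→ℚ B        ≡⟨ right P (ℕ→ℚ B) ⟩
      ℕ→ℚ 3 * (ℕ→ℚ 2 + P - ℕ→ℚ 1) * ℕ→ℚ B ≡⟨ cong (λ x → ℕ→ℚ 3 * (x - ℕ→ℚ 1) * ℕ→ℚ B) (sym m≡) ⟩
      ℕ→ℚ 3 * (m - ℕ→ℚ 1) * ℕ→ℚ B        ∎
      where
      open ≡-Reasoning
      left : ∀ P A → (ℕ→ℚ 2 + P + ℕ→ℚ 1) * A ≡ (P + ℕ→ℚ 3) * A
      left = solve-∀ ℚ-ring
      right : ∀ P B → ℕ→ℚ 3 * (P + ℕ→ℚ 1) * B ≡ ℕ→ℚ 3 * (ℕ→ℚ 2 + P - ℕ→ℚ 1) * B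
      right = solve-∀ ℚ-ring

    absorptionℚ : ∀ r → degree * ℕ→ℚ (M C r) + ℕ→ℚ r * ℕ→ℚ (K C r) ≡ degree * ℕ→ℚ (K C r)
    absorptionℚ r = begin
      degree * ℕ→ℚ (M C r) + ℕ→ℚ r * ℕ→ℚ (K C r)
        ≡⟨ cong (λ x → x * ℕ→ℚ (M C r) + ℕ→ℚ r * ℕ→ℚ (K C r)) (sym K≡degree) ⟩
      ℕ→ℚ K * ℕ→ℚ (M C r) + ℕ→ℚ r * ℕ→ℚ (K C r)
        ≡⟨ sym (trans (ℕ→ℚ-+ (K ℕ.* (M C r)) (r ℕ.* (K C r))) (cong₂ _+_ (ℕ→ℚ-* K (M C r)) (ℕ→ℚ-* r (K C r)))) ⟩
      ℕ→ℚ (K ℕ.* (M C r) ℕ.+ r ℕ.* (K C r))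
        ≡⟨ cong ℕ→ℚ (subst (λ k → k ℕ.* (M C r) ℕ.+ r ℕ.* (k C r) ≡ k ℕ.* (k C r)) (sym K≡suc-M)
                            ([n+1]*nCk+k*[n+1]Ck≡[n+1]*[n+1]Ck M r)) ⟩
      ℕ→ℚ (K ℕ.* (K C r))
        ≡⟨ trans (ℕ→ℚ-* K (K C r)) (cong (_* ℕ→ℚ (K C r)) K≡degree) ⟩
      degree * ℕ→ℚ (K C r) ∎
      where
      open ≡-Reasoning
      K≡suc-M : K ≡ suc M
      K≡suc-M = size p
        where
        size : ∀ p → p ℕ.+ (p ℕ.+ 2) ≡ suc (p ℕ.+ (p ℕ.+ 1))
        size = ℕ-solve-∀

    μ : ℚ
    μ = degree * (m + ℕ→ℚ 1)

    μ-positive : Positive μ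
    μ-positive = subst Positive μ≡ (normalize-pos (K ℕ.* suc n) 1 {{_}} {{ℕ.m*n≢0 K (suc n) {{K≢0}}}})
      where
      K≢0 : ℕ.NonZero K
      K≢0 = subst ℕ.NonZero (sym (K≡ p)) _
        where
        K≡ : ∀ p → p ℕ.+ (p ℕ.+ 2) ≡ suc (suc (p ℕ.+ p))
        K≡ = ℕ-solve-∀
      μ≡ : ℕ→ℚ (K ℕ.* suc n) ≡ μ
      μ≡ = trans (ℕ→ℚ-* K (suc n)) (cong₂ _*_ K≡degree (ℕ→ℚ-suc n))

    s : ℕ → ℚ
    s r = ℕ→ℚ B * binomialTerm K r

    s-kummer : ∀ r → let x = ℕ→ℚ r in (x + 1ℚ) * (x + 1ℚ) * s (suc r) ≡ (degree - x) * s r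
    s-kummer r = begin
      (x + 1ℚ) * (x + 1ℚ) * (ℕ→ℚ B * binomialTerm K (suc r))
        ≡⟨ regroup (x + 1ℚ) (ℕ→ℚ B) (binomialTerm K (suc r)) ⟩
      ℕ→ℚ B * ((x + 1ℚ) * (x + 1ℚ) * binomialTerm K (suc r))
        ≡⟨ cong (ℕ→ℚ B *_) (binomialTerm-kummer K r) ⟩
      ℕ→ℚ B * ((ℕ→ℚ K - x) * binomialTerm K r)
        ≡⟨ cong (λ k → ℕ→ℚ B * ((k - x) * binomialTerm K r)) K≡degree ⟩
      ℕ→ℚ B * ((degree - x) * binomialTerm K r)
        ≡⟨ regroup′ (ℕ→ℚ B) (degree - x) (binomialTerm K r) ⟩
      (degree - x) * (ℕ→ℚ B * binomialTerm K r) ∎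
      where
      open ≡-Reasoning
      x = ℕ→ℚ r
      regroup : ∀ y β t → y * y * (β * t) ≡ β * (y * y * t)
      regroup = solve-∀ ℚ-ring
      regroup′ : ∀ β u t → β * (u * t) ≡ u * (β * t)
      regroup′ = solve-∀ ℚ-ring

    Cstar≡ : ∀ r → μ * Cstar n r ≡ s r * Q (ℕ→ℚ r)
    Cstar≡ r = begin
      μ * Cstar n r
        ≡⟨ cong (μ *_) (trans (companion-closed r) (cong (_* w r) casts)) ⟩
      degree * (m + ℕ→ℚ 1) * ((c₁ * ℕ→ℚ A + c₀ * ℕ→ℚ B) * w r)
        ≡⟨ expand degree m x (ℕ→ℚ A) (ℕ→ℚ B) c₀ c₁ (w r) ⟩
      degree * c₁ * w r * ((m + ℕ→ℚ 1) * ℕ→ℚ A)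
        + (m + ℕ→ℚ 1) * ℕ→ℚ B * w r * (degree * c₀ + x * c₁) - (m + ℕ→ℚ 1) * ℕ→ℚ B * w r * (x * c₁)
        ≡⟨ cong₂ (λ u v → degree * c₁ * w r * u + (m + ℕ→ℚ 1) * ℕ→ℚ B * w r * v - (m + ℕ→ℚ 1) * ℕ→ℚ B * w r * (x * c₁))
                 ballot-ratioℚ (absorptionℚ r) ⟩
      degree * c₁ * w r * (ℕ→ℚ 3 * (m - ℕ→ℚ 1) * ℕ→ℚ B)
        + (m + ℕ→ℚ 1) * ℕ→ℚ B * w r * (degree * c₁) - (m + ℕ→ℚ 1) * ℕ→ℚ B * w r * (x * c₁)
        ≡⟨ collect m x (ℕ→ℚ B) c₁ (w r) ⟩
      ℕ→ℚ B * (c₁ * w r) * Q x ∎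
      where
      open ≡-Reasoning
      x = ℕ→ℚ r
      c₀ = ℕ→ℚ (M C r)
      c₁ = ℕ→ℚ (K C r)
      casts : ℤ→ℚ (+ (K C r) ℤ.* + A ℤ.+ + (M C r) ℤ.* + B) ≡ c₁ * ℕ→ℚ A + c₀ * ℕ→ℚ B
      casts = trans (ℤ→ℚ-+ (+ (K C r) ℤ.* + A) (+ (M C r) ℤ.* + B))
                    (cong₂ _+_ (ℤ→ℚ-* (+ (K C r)) (+ A)) (ℤ→ℚ-* (+ (M C r)) (+ B)))
      expand : ∀ N m x A B c₀ c₁ w → N * (m + ℕ→ℚ 1) * ((c₁ * A + c₀ * B) * w)
        ≡ N * c₁ * w * ((m + ℕ→ℚ 1) * A) + (m + ℕ→ℚ 1) * B * w * (N * c₀ + x * c₁) - (m + ℕ→ℚ 1) * B * w * (x * c₁)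
      expand = solve-∀ ℚ-ring
      collect : ∀ m x B c₁ w →
        let N = ℕ→ℚ 2 * m - ℕ→ℚ 2 in
        N * c₁ * w * (ℕ→ℚ 3 * (m - ℕ→ℚ 1) * B) + (m + ℕ→ℚ 1) * B * w * (N * c₁) - (m + ℕ→ℚ 1) * B * w * (x * c₁)
          ≡ B * (c₁ * w) * (ℕ→ℚ 4 * (m - ℕ→ℚ 1) * (ℕ→ℚ 2 * m - ℕ→ℚ 1) - (m + ℕ→ℚ 1) * x)
      collect = solve-∀ ℚ-ring

    annihilated : ∀ k → operator a b c d (Cstar n) k ≡ 0ℚ
    annihilated = annihilates a b c d degree (Q ∘ ℕ→ℚ) Q-initial q-step s s-kummer μ {{μ-positive}} (Cstar n) Cstar≡
      where
      q-step : ∀ j → let x = ℕ→ℚ j in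
        b * (degree - (x + 1ℚ)) * (degree - x) * Q (ℕ→ℚ (2 ℕ.+ j))
        + (a * x * (x + 1ℚ) + b * (x + 1ℚ) - d) * (degree - x) * Q (ℕ→ℚ (suc j))
        + (a * x + c) * ((x + 1ℚ) * (x + 1ℚ)) * Q x ≡ 0ℚ
      q-step j = subst₂ (λ u v → b * (degree - (x + 1ℚ)) * (degree - x) * Q u
                                 + (a * x * (x + 1ℚ) + b * (x + 1ℚ) - d) * (degree - x) * Q v
                                 + (a * x + c) * ((x + 1ℚ) * (x + 1ℚ)) * Q x ≡ 0ℚ)
                        (sym (trans (ℕ→ℚ-suc (suc j)) (cong (_+ 1ℚ) (ℕ→ℚ-suc j)))) (sym (ℕ→ℚ-suc j)) (Q-step x)
        where x = ℕ→ℚ j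

open import Defs
open import Data.Nat using (ℕ; suc; _≤_; s≤s; z≤n)
open import Data.Rational using (ℚ; 0ℚ; _+_; _*_; _-_)
open import Relation.Binary.PropositionalEquality using (_≡_)

mainTheorem13 : (n : ℕ) → 2 ≤ n →
  let Y = Cstar n
      m = ℕ→ℚ n
      a = ℕ→ℚ 3 * (m + ℕ→ℚ 1)
      b = ℕ→ℚ 8 * ((ℕ→ℚ 2 * m - ℕ→ℚ 1) * (ℕ→ℚ 2 * m - ℕ→ℚ 1))
      c = ℕ→ℚ 6 * (m + ℕ→ℚ 1) * (ℕ→ℚ 1 - m)
      d = ℕ→ℚ 4 * (ℕ→ℚ 2 * m - ℕ→ℚ 1) * (ℕ→ℚ 8 * m * m - ℕ→ℚ 13 * m + ℕ→ℚ 3)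
      Y′ = D Y
      Y″ = D (D Y)
      lhs = ((a · mulX (mulX Y″)) ⊕ (b · mulX Y″))
          ⊕ (((a · mulX (mulX Y′)) ⊕ (b · mulX Y′)) ⊕ (b · Y′))
          ⊕ ((c · mulX Y) ⊕ ((0ℚ - d) · Y))
  in ∀ k → lhs k ≡ 0ℚ
mainTheorem13 (suc (suc p)) (s≤s (s≤s z≤n)) = CatalanPolynomial.CatalanSolution.annihilated p
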